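{- Let $\Gamma=(G_0,\ldots,G_{n-1})$ be parametric games, $I\subseteq\mathrm{Par}$ a self-dual set of parameters, and $G=\forall I.\Gamma$, and assume $\mathrm{FV}(G)=\emptyset$. The following are equivalent: (1) there is an $I$-assignment $\eta:I\to\{\mathsf P,\mathsf O\}$ such that for every $i<n$ there is an $\mathsf O$-winning strategy $\tau_i:\eta(G_i)$; (2) there is an $\mathsf O$-winning strategy for $G$; (3) there is no $\mathsf P$-winning strategy for $G$; (4) the primitive recursive exhaustive strategy $\mathrm{EXH}$ for $G$ is not $\mathsf P$-winning.
   Context: Players: $\mathsf P$ (Player), $\mathsf O$ (Opponent), $\mathsf P^\bot=\mathsf O$, $\mathsf O^\bot=\mathsf P$. Fix a countable set $M$ of moves and a countable set $\mathrm{Par}$ with an involution $a\mapsto a^\bot$ without fixed points; $J\subseteq\mathrm{Par}$ is self-dual if $J^\bot=J$. $\langle\rangle$ is the empty list, $x@y$ concatenation, $x@S=\{x@s:s\in S\}$. A tree support is a set $T$ of finite lists over $M$ containing $\langle\rangle$ and closed under prefixes; leaves are nodes without one-step extension in $T$; $T_\infty$ is the set of infinite sequences with all finite prefixes in $T$. A parametric game $G$: a tree support $|G|$ with an enumeration of the children of each node, $\mathrm{turn}_G$: non-leaves $\to\{\mathsf P,\mathsf O\}$, $\mathrm{win}_G$: leaves $\to\{\mathsf P,\mathsf O\}\cup\mathrm{Par}$, a partition $(G_{\mathsf P},G_{\mathsf O})$ of $|G|_\infty$. $\mathrm{FV}(G)$ is the smallest self-dual set containing $\mathrm{win}_G(\text{leaves})\cap\mathrm{Par}$.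 A $J$-assignment ($J$ self-dual) is $\rho:J\to\{\mathsf P,\mathsf O\}$ with $\rho(a^\bot)=\rho(a)^\bot$, extended by $\rho(g)=g$; $\rho(G)$ is $G$ with $\mathrm{win}_G$ replaced by $\rho\circ\mathrm{win}_G$. $G_x$ is the subgame at $x$. $\mathrm{END}(x)$ is the one-position game with root leaf labelled $x$; $G$ is atomic if $|G|=\{\langle\rangle\}$. A strategy $\sigma:G$ is a tree support $\sigma\subseteq|G|$. It is a $g$-strategy if for every non-leaf $p\in\sigma$ with $\mathrm{turn}_G(p)=g^\bot$ all one-step extensions of $p$ in $|G|$ lie in $\sigma$; $g$-total if moreover each non-leaf $p\in\sigma$ with $\mathrm{turn}_G(p)=g$ has a one-step extension in $\sigma$; $g$-partially winning if moreover $\mathrm{win}_G(p)=g$ for every leaf $p$ of $|G|$ in $\sigma$; $g$-winning if moreover all infinite branches of $\sigma$ are in $G_g$. The game $\forall I.\Gamma$: $M$ contains primitive recursive injective constructors $\mathrm{DROP}(n),\mathrm{EM}(n,m),\mathrm{STOP}(n),\mathrm{JUST}(n,m),\mathrm{nth}(n)$ with disjoint ranges covering $M$. $\mathrm{FV}(\Gamma)=\bigcup_i\mathrm{FV}(G_i)$. The root has local positions $G_0,\ldots,G_{n-1}$. If $p=\langle\mathrm{JUST}(i_0,n),m_0,\ldots,\mathrm{JUST}(i_{k-1},n+k-1),m_{k-1}\rangle$ has local positions $G_0,\ldots,G_{n+k-1}$, then $\mathrm{turn}(p)=\mathsf P$ and $p@m$ is a position iff: $m=\mathrm{DROP}(n+k)$;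 or $m=\mathrm{EM}(i,j)$ with $i,j<n+k$, $G_i=\mathrm{END}(a)$, $G_j=\mathrm{END}(a^\bot)$, $a\in I$; or $m=\mathrm{STOP}(i)$ with $i<n+k$, $G_i=\mathrm{END}(x)$, $x\in\{\mathsf P,\mathsf O\}\cup(\mathrm{FV}(\Gamma)\setminus I)$; or $m=\mathrm{JUST}(i_k,n+k)$ with $i_k<n+k$, $G_{i_k}$ not atomic. The first three are leaves with winner $\mathsf O$, $\mathsf P$, $\mathrm{win}_{G_i}(\langle\rangle)$. If $p_1=p@\mathrm{JUST}(i_k,n+k)$, $\mathrm{turn}(p_1)=\mathrm{turn}_{G_{i_k}}(\langle\rangle)$, and $p_1@m_k$ is a position iff $\langle m_k\rangle\in|G_{i_k}|$; its local positions are $G_0,\ldots,G_{n+k}$ with $G_{n+k}=(G_{i_k})_{\langle m_k\rangle}$, and $i_k\vdash_{m_k}n+k$. For infinite plays use the union over finite prefixes. For finite $q=\langle m_0,\ldots,m_{r-1}\rangle$, $q\prec_i p$ if there are indices $i=j_0<\cdots<j_r$ with $j_s\vdash_{m_s}j_{s+1}$ in $p$; for infinite $q$, if there is an infinite such chain. $G_{\mathsf P}$: infinite $p$ with some infinite $q\prec_i p$ ($i<n$) in $(G_i)_{\mathsf P}$; $G_{\mathsf O}$: the other infinite plays. $\mathrm{FV}(\forall I.\Gamma)=\mathrm{FV}(\Gamma)\setminus I$. The strategy $\mathrm{EXH}=\mathrm{exh}(0,n,n,\emptyset)$, where $\mathrm{exh}(i,c,q,J)$ ($i\le c\le q$, $J$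 a list of triples; $G_0,\ldots,G_{q-1}$ the current local positions) is given by the first applicable clause: (REPEAT) $i=c<q$: $\mathrm{exh}(0,q,q,J)$. (DROP) $i=c=q$: $\{\langle\rangle,\langle\mathrm{DROP}(q)\rangle\}$. (EM) $i<c$, $G_i=\mathrm{END}(a)$, $a\in I$, and there is a least $j<c$ with $G_j=\mathrm{END}(a^\bot)$: $\{\langle\rangle,\langle\mathrm{EM}(i,j)\rangle\}$. (STOP) $i<c$, $G_i=\mathrm{END}(\mathsf P)$: $\{\langle\rangle,\langle\mathrm{STOP}(i)\rangle\}$. (SKIP) $i<c$, $G_i$ atomic: $\mathrm{exh}(i+1,c,q,J)$. (TRYALL) $i<c$, $G_i$ not atomic, $K$ the set of moves from the root of $G_i$: (a) if $\mathrm{turn}_{G_i}(\langle\rangle)=\mathsf P$ and some $m\in K$ has no triple $(i,m,k)$ in $J$, take the first such $m$ and set $\mathrm{exh}=\{\langle\rangle,\langle\mathrm{JUST}(i,q)\rangle\}\cup\mathrm{JUST}(i,q)@m@\mathrm{exh}(i+1,c,q+1,J@(i,m,q))$, else $\mathrm{exh}(i+1,c,q,J)$; (b) if $\mathrm{turn}_{G_i}(\langle\rangle)=\mathsf O$ and $J$ has no triple $(i,m,k)$, set $\mathrm{exh}=\{\langle\rangle,\langle\mathrm{JUST}(i,q)\rangle\}\cup\bigcup_{m\in K}\mathrm{JUST}(i,q)@m@\mathrm{exh}(i+1,c,q+1,J@(i,m,q))$, else $\mathrm{exh}(i+1,c,q,J)$. (After the moves $\mathrm{JUST}(i,q),m$,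 the local position $G_q=(G_i)_{\langle m\rangle}$ is added.) $\mathrm{EXH}$ is primitive recursive relative to the finitary parts (all data except the partitions) of $G_0,\ldots,G_{n-1}$. -}

module Defs where

open import Level using (0ℓ)
open import Data.Nat using (ℕ; zero; suc; _<_; _*_; _∸_; _<ᵇ_) renaming (_≡ᵇ_ to _==ℕ_)
open import Data.Bool using (Bool; true; false; if_then_else_; _∧_; not)
open import Data.Fin using (Fin; toℕ)
open import Data.List using (List; []; _∷_; _++_; [_]; length; map; allFin)
open import Data.Bool.ListAction using (any)
open import Data.List.Membership.Propositional using (_∈_)
open import Data.List.Relation.Unary.Unique.Propositional using (Unique)
open import Data.Maybe using (Maybe; just; nothing)
open import Data.Product using (Σ; _×_; _,_; proj₁)
open import Data.Unit using (⊤)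
open import Data.Sum using (_⊎_)
open import Data.Empty using (⊥)
open import Function.Definitions using (Injective)
open import Relation.Nullary using (¬_; Dec; yes; no)
open import Relation.Nullary.Decidable using (⌊_⌋)
open import Relation.Binary.PropositionalEquality using (_≡_; _≢_)

-- Moves.  M is realised as the datatype freely generated by the five
-- constructors: they are injective, with disjoint ranges covering M,
-- and M is countable.

data Move : Set where
  DROP : ℕ → Move
  EM   : ℕ → ℕ → Move
  STOP : ℕ → Move
  JUST : ℕ → ℕ → Move
  nth  : ℕ → Move

_==M_ : Move → Move → Bool
DROP a   ==M DROP b   = a ==ℕ b
EM a b   ==M EM c d   = (a ==ℕ c) ∧ (b ==ℕ d)
STOP a   ==M STOP b   = a ==ℕ b
JUST a b ==M JUST c d = (a ==ℕ c) ∧ (b ==ℕ d)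
nth a    ==M nth b    = a ==ℕ b
_        ==M _        = false

_!!_ : {A : Set} → List A → ℕ → Maybe A
[]       !! _     = nothing
(x ∷ xs) !! zero  = just x
(x ∷ xs) !! suc i = xs !! i

prefix : (ℕ → Move) → ℕ → List Move
prefix p zero    = []
prefix p (suc k) = prefix p k ++ [ p k ]

data Player : Set where
  P O : Player

_ᵒᵖ : Player → Player
P ᵒᵖ = O
O ᵒᵖ = P

record ParSig : Set₁ where
  field
    Par       : Set
    _≟_       : (a b : Par) → Dec (a ≡ b)
    dual      : Par → Par
    dual-invol : ∀ a → dual (dual a) ≡ a
    dual-nofix : ∀ a → dual a ≢ a
    enc       : Par → ℕ
    enc-inj   : Injective _≡_ _≡_ enc      -- countability

module WithPar (𝒫 : ParSig) where
  open ParSig 𝒫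

  data Label : Set where
    pl  : Player → Label
    par : Par → Label

  _==L_ : Label → Label → Bool
  pl P  ==L pl P  = true
  pl O  ==L pl O  = true
  par a ==L par b = ⌊ a ≟ b ⌋
  _     ==L _     = false

  data Enum : Set where
    fin : List Move → Enum
    inf : (ℕ → Move) → Enum

  _∈E_ : Move → Enum → Set
  m ∈E fin xs = m ∈ xs
  m ∈E inf f  = Σ ℕ λ t → f t ≡ m

  isEmptyE : Enum → Bool
  isEmptyE (fin []) = true
  isEmptyE _        = false

  -- The tree support |G| is generated from the root
  -- by the enumerations of children (kids x is meaningful for x ∈ |G|);
  -- turn is meaningful on non-leaves, win on leaves; Pwin is G_P, and
  -- G_O is its complement in |G|_∞.

  record Game : Set₁ where
    field
      kids     : List Move → Enum
      turn     : List Move → Player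
      win      : List Move → Label
      Pwin     : (ℕ → Move) → Set
      kids-fin : ∀ x xs → kids x ≡ fin xs → Unique xs
      kids-inf : ∀ x f → kids x ≡ inf f → Injective _≡_ _≡_ f
  open Game public

  -- y ++ x ∈ |G|, given y ∈ |G|
  PosFrom : Game → List Move → List Move → Set
  PosFrom G y []       = ⊤
  PosFrom G y (m ∷ xs) = (m ∈E kids G y) × PosFrom G (y ++ [ m ]) xs

  Pos : Game → List Move → Set
  Pos G = PosFrom G []

  IsLeafG : Game → List Move → Set
  IsLeafG G x = Pos G x × kids G x ≡ fin []

  -- a ∈ FV(G): the smallest self-dual set containing the Par-labels of leaves
  InFV : Game → Par → Set
  InFV G a = Σ (List Move) λ x → IsLeafG G x × ((win G x ≡ par a) ⊎ (win G x ≡ par (dual a)))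

  SelfDual : (Par → Bool) → Set
  SelfDual I = ∀ a → I (dual a) ≡ I a

  -- J-assignments (J given by a decidable self-dual set); represented as
  -- total functions whose values outside J are irrelevant
  IsAssignment : (Par → Bool) → (Par → Player) → Set
  IsAssignment J η = ∀ a → J a ≡ true → η (dual a) ≡ (η a) ᵒᵖ

  applyA : (Par → Bool) → (Par → Player) → Label → Label
  applyA J η (pl g)  = pl g
  applyA J η (par a) = if J a then pl (η a) else par a

  assignG : (Par → Bool) → (Par → Player) → Game → Game
  assignG J η G = record
    { kids = kids G ; turn = turn G
    ; win = λ x → applyA J η (win G x)
    ; Pwin = Pwin G ; kids-fin = kids-fin G ; kids-inf = kids-inf G }

  record Arena : Set₁ where
    field
      APos  : List Move → Set
      Aturn : List Move → Player
      Awin  : List Move → Label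
      APwin : (ℕ → Move) → Set
  open Arena public

  gameArena : Game → Arena
  gameArena G = record { APos = Pos G ; Aturn = turn G ; Awin = win G ; APwin = Pwin G }

  module _ (A : Arena) where
    NonLeaf : List Move → Set
    NonLeaf x = Σ Move λ m → APos A (x ++ [ m ])

    Leaf : List Move → Set
    Leaf x = APos A x × (∀ m → ¬ APos A (x ++ [ m ]))

    IsStrategy : (List Move → Set) → Set
    IsStrategy σ = (∀ x → σ x → APos A x) × σ [] × (∀ x y → σ (x ++ y) → σ x)

    IsGStrategy : Player → (List Move → Set) → Set
    IsGStrategy g σ = IsStrategy σ ×
      (∀ x → σ x → NonLeaf x → Aturn A x ≡ g ᵒᵖ → ∀ m → APos A (x ++ [ m ]) → σ (x ++ [ m ]))

    IsGTotal : Player → (List Move → Set) → Set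
    IsGTotal g σ = IsGStrategy g σ ×
      (∀ x → σ x → NonLeaf x → Aturn A x ≡ g → Σ Move λ m → σ (x ++ [ m ]))

    IsGPartiallyWinning : Player → (List Move → Set) → Set
    IsGPartiallyWinning g σ = IsGTotal g σ × (∀ x → σ x → Leaf x → Awin A x ≡ pl g)

    InfWin : Player → (ℕ → Move) → Set
    InfWin P p = APwin A p
    InfWin O p = ¬ APwin A p

    IsGWinning : Player → (List Move → Set) → Set
    IsGWinning g σ = IsGPartiallyWinning g σ ×
      (∀ (p : ℕ → Move) → (∀ k → σ (prefix p k)) → InfWin g p)

  module Forall (n : ℕ) (Γ : Fin n → Game) (I : Par → Bool) where

    -- a local position (G_g)_y
    Loc : Set
    Loc = Fin n × List Move

    kidsL : Loc → Enum
    kidsL (g , y) = kids (Γ g) y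

    winL : Loc → Label
    winL (g , y) = win (Γ g) y

    turnL : Loc → Player
    turnL (g , y) = turn (Γ g) y

    IsEND : List Loc → ℕ → Label → Set
    IsEND L i x = Σ Loc λ l → (L !! i ≡ just l) × (kidsL l ≡ fin []) × (winL l ≡ x)

    -- labels allowed for STOP: players, or parameters not in I
    -- (labels of local leaves automatically lie in FV(Γ))
    Free : Label → Set
    Free (pl _)  = ⊤
    Free (par a) = I a ≡ false

    -- states of the game: at a P-node with the given local positions,
    -- after JUST(i,q) pointing to a local position, or at a leaf
    data FState : Set where
      atP   : List Loc → FState
      atJ   : List Loc → Loc → FState
      ended : Label → FState

    Legal : FState → Move → Set
    Legal (atP L) (DROP k)   = k ≡ length L
    Legal (atP L) (EM i j)   = Σ Par λ a → IsEND L i (par a) × IsEND L j (par (dual a)) × I a ≡ true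
    Legal (atP L) (STOP i)   = Σ Label λ x → IsEND L i x × Free x
    Legal (atP L) (JUST i k) = k ≡ length L × Σ Loc λ l → (L !! i ≡ just l) × (kidsL l ≢ fin [])
    Legal (atP L) (nth _)    = ⊥
    Legal (atJ L l) m        = m ∈E kidsL l
    Legal (ended _) m        = ⊥

    -- the successor state (values at illegal moves are irrelevant)
    step : FState → Move → FState
    step (atP L) (DROP _)   = ended (pl O)
    step (atP L) (EM _ _)   = ended (pl P)
    step (atP L) (STOP i) with L !! i
    ... | just l  = ended (winL l)
    ... | nothing = ended (pl O)
    step (atP L) (JUST i _) with L !! i
    ... | just l  = atJ L l
    ... | nothing = ended (pl O)
    step (atP L) (nth _)    = ended (pl O)
    step (atJ L (g , y)) m  = atP (L ++ [ (g , y ++ [ m ]) ])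
    step (ended x) m        = ended x

    run : FState → List Move → FState
    run s []       = s
    run s (m ∷ ms) = run (step s m) ms

    ValidFrom : FState → List Move → Set
    ValidFrom s []       = ⊤
    ValidFrom s (m ∷ ms) = Legal s m × ValidFrom (step s m) ms

    initLocs : List Loc
    initLocs = map (λ g → (g , [])) (allFin n)

    init : FState
    init = atP initLocs

    turnS : FState → Player
    turnS (atP _)   = P
    turnS (atJ _ l) = turnL l
    turnS (ended _) = P

    winS : FState → Label
    winS (ended x) = x
    winS _         = pl O

    Derives : (ℕ → Move) → ℕ → Move → ℕ → Set
    Derives p j m j' = Σ ℕ λ t → (p (2 * t) ≡ JUST j j') × (p (suc (2 * t)) ≡ m)

    Prec : ℕ → (ℕ → Move) → (ℕ → Move) → Set
    Prec i q p = Σ (ℕ → ℕ) λ js → (js 0 ≡ i) ×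
      (∀ s → (js s < js (suc s)) × Derives p (js s) (q s) (js (suc s)))

    ForallPwin : (ℕ → Move) → Set
    ForallPwin p = Σ (Fin n) λ i → Σ (ℕ → Move) λ q → Prec (toℕ i) q p × Pwin (Γ i) q

    ForallArena : Arena
    ForallArena = record
      { APos = ValidFrom init
      ; Aturn = λ x → turnS (run init x)
      ; Awin = λ x → winS (run init x)
      ; APwin = ForallPwin }

    Triples : Set
    Triples = List (ℕ × Move × ℕ)

    isENDb : List Loc → ℕ → Label → Bool
    isENDb L j x with L !! j
    ... | just l  = isEmptyE (kidsL l) ∧ (winL l ==L x)
    ... | nothing = false

    findEND : List Loc → Label → ℕ → ℕ → Maybe ℕ
    findEND L x zero    j = nothing
    findEND L x (suc k) j = if isENDb L j x then just j else findEND L x k (suc j)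

    inJ : ℕ → Move → Triples → Bool
    inJ i m = any (λ { (i' , m' , _) → (i' ==ℕ i) ∧ (m' ==M m) })

    hasI : ℕ → Triples → Bool
    hasI i = any (λ { (i' , _ , _) → i' ==ℕ i })

    firstFreeList : ℕ → Triples → List Move → Maybe Move
    firstFreeList i J []       = nothing
    firstFreeList i J (m ∷ ms) = if inJ i m J then firstFreeList i J ms else just m

    firstFreeSeq : ℕ → Triples → (ℕ → Move) → ℕ → ℕ → Maybe Move
    firstFreeSeq i J f zero    t = nothing
    firstFreeSeq i J f (suc k) t = if inJ i (f t) J then firstFreeSeq i J f k (suc t) else just (f t)

    -- first move from the enumeration with no triple (i,m,k) in J; for an
    -- injective infinite enumeration one of the first |J|+1 entries is free
    firstFree : ℕ → Triples → Enum → Maybe Move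
    firstFree i J (fin ms) = firstFreeList i J ms
    firstFree i J (inf f)  = firstFreeSeq i J f (suc (length J)) 0

    data Act : Set where
      leafMove : Move → Act
      justP    : ℕ → Loc → Move → ℕ → Act     -- TRYALL(a): i, G_i, m, c
      justO    : ℕ → Loc → ℕ → Act            -- TRYALL(b): i, G_i, c

    -- the clauses EM, STOP, SKIP, TRYALL for i, i+1, …, i+k-1 (here k = c - i)
    scan : List Loc → Triples → ℕ → ℕ → ℕ → Maybe Act
    scan L J c zero    i = nothing
    scan L J c (suc k) i with L !! i
    ... | nothing = scan L J c k (suc i)
    ... | just l  = clause (isEmptyE (kidsL l)) (winL l) (turnL l)
      where
      skip : Maybe Act
      skip = scan L J c k (suc i)
      clause : Bool → Label → Player → Maybe Act
      clause true (par a) _ with I a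
      ... | false = skip
      ... | true with findEND L (par (dual a)) c 0
      ...   | just j  = just (leafMove (EM i j))
      ...   | nothing = skip
      clause true (pl P) _ = just (leafMove (STOP i))
      clause true (pl O) _ = skip
      clause false _ P with firstFree i J (kidsL l)
      ... | just m  = just (justP i l m c)
      ... | nothing = skip
      clause false _ O = if hasI i J then skip else just (justO i l c)

    -- exh(i,c,q,J) with q = length L: the clauses REPEAT and DROP handled here
    exhAct : List Loc → ℕ → ℕ → Triples → Act
    exhAct L i c J with scan L J c (c ∸ i) i
    ... | just a  = a
    ... | nothing with c <ᵇ length L
    ...   | false = leafMove (DROP (length L))
    ...   | true with scan L J (length L) (length L) 0
    ...     | just a  = a
    ...     | nothing = leafMove (DROP (length L))

    firstMove : ℕ → Act → Move
    firstMove q (leafMove m)    = m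
    firstMove q (justP i _ _ _) = JUST i q
    firstMove q (justO i _ _)   = JUST i q

    extendL : List Loc → Loc → Move → List Loc
    extendL L (g , y) m = L ++ [ (g , y ++ [ m ]) ]

    InExh : List Loc → ℕ → ℕ → Triples → List Move → Set
    InExh L i c J [] = ⊤
    InExh L i c J (x ∷ []) = x ≡ firstMove (length L) (exhAct L i c J)
    InExh L i c J (x ∷ m ∷ ys) = go (exhAct L i c J)
      where
      go : Act → Set
      go (leafMove _) = ⊥
      go (justP i' l m' c') = (x ≡ JUST i' (length L)) × (m ≡ m') ×
        InExh (extendL L l m') (suc i') c' (J ++ [ (i' , m' , length L) ]) ys
      go (justO i' l c') = (x ≡ JUST i' (length L)) × (m ∈E kidsL l) ×
        InExh (extendL L l m) (suc i') c' (J ++ [ (i' , m , length L) ]) ys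

    EXH : List Move → Set
    EXH = InExh initLocs 0 n []

  -- FV(∀I.Γ) = FV(Γ) \ I is empty
  FVEmpty : (n : ℕ) → (Fin n → Game) → (Par → Bool) → Set
  FVEmpty n Γ I = ∀ i a → InFV (Γ i) a → I a ≡ true

-- (1) ⇒ (2): O answers in every local position G_g with τ_g. All local positions then stay inside
-- the τ_g, so every STOP reaches an O-leaf of η(G_g), EM never applies because η(a^⊥) = η(a)^⊥, and an
-- infinite local play q ≺ p is a play of some τ_g. (2) ⇒ (3) ⇒ (4) are immediate.
-- (4) ⇒ (1): EXH tries every P-move and one O-move at each local position, round after round, and
-- plays EM or STOP as soon as it can. So a play of EXH that P does not win (a DROP after an
-- exhausted round, or an infinite play) visits in each G_g an O-strategy that meets no P-leaf, no
-- pair a, a^⊥ of leaves with a ∈ I, and no P-won play; letting η make its parameter leaves O-leaves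
-- gives (1). Classical logic is used to decide which plays exist and to define η.

module Submission where

open import Defs
open import Level using (0ℓ; Lift; lift)
open import Data.Nat using (ℕ; zero; suc; _<_; _≤_; _≤′_; ≤′-refl; ≤′-step; z≤n; s≤s; _+_; _*_; _∸_; _<ᵇ_)
  renaming (_≡ᵇ_ to _==ℕ_)
open import Data.Nat.Properties hiding (_≟_)
open import Data.Bool using (Bool; true; false; if_then_else_; T; _∧_; _∨_)
open import Data.Fin using (Fin; toℕ) renaming (zero to fzero; suc to fsuc)
open import Data.Fin.Properties using (pigeonhole; toℕ<n) renaming (suc-injective to fsuc-injective)
open import Data.List using (List; []; _∷_; _++_; [_]; length; tabulate)
open import Data.List.Properties using (++-assoc; ++-identityʳ; length-++; ∷ʳ-injective; map-tabulate; length-tabulate)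
open import Data.List.Membership.Propositional using (_∈_)
open import Data.List.Membership.Propositional.Properties using (∈-++⁺ˡ; ∈-++⁺ʳ; ∈-++⁻)
open import Data.List.Relation.Unary.Any using (here; there; index)
open import Data.Maybe using (Maybe; just; nothing; _<∣>_)
open import Data.Maybe.Properties using (just-injective)
open import Data.Product using (Σ; _×_; _,_; proj₁; proj₂)
open import Data.Product.Properties using (,-injective)
open import Data.Sum using (_⊎_; inj₁; inj₂)
open import Data.Empty using (⊥; ⊥-elim)
open import Data.Unit using (tt)
open import Function.Base using (_∘_)
open import Function.Bundles using (_⇔_; mk⇔)
open import Function.Definitions using (Injective)
open import Relation.Nullary using (¬_; Dec; yes; no)
open import Relation.Binary using (tri<; tri≈; tri>)
open import Relation.Binary.PropositionalEquality hiding ([_]; J)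
open import Axiom.ExcludedMiddle using (ExcludedMiddle)

decide : ExcludedMiddle (Level.suc 0ℓ) → (X : Set) → Dec X
decide em X with em {Lift (Level.suc 0ℓ) X}
... | yes (lift x) = yes x
... | no ¬x = no (λ x → ¬x (lift x))

module _ {A : Set} where

  length-∷ʳ : (L : List A) (x : A) → length (L ++ [ x ]) ≡ suc (length L)
  length-∷ʳ L x = trans (length-++ L) (+-comm (length L) 1)

  nothing≢just : ∀ {x : A} → nothing ≢ just x
  nothing≢just ()

  ∷ʳ≢[] : (L : List A) {x : A} → L ++ [ x ] ≢ []
  ∷ʳ≢[] [] ()
  ∷ʳ≢[] (_ ∷ _) ()

  !!-++ˡ : ∀ (L L' : List A) k {x} → L !! k ≡ just x → (L ++ L') !! k ≡ just x
  !!-++ˡ (y ∷ L) L' zero eq = eq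
  !!-++ˡ (y ∷ L) L' (suc k) eq = !!-++ˡ L L' k eq

  !!-∷ʳ-length : ∀ (L : List A) x → (L ++ [ x ]) !! length L ≡ just x
  !!-∷ʳ-length [] x = refl
  !!-∷ʳ-length (y ∷ L) x = !!-∷ʳ-length L x

  !!⇒<length : ∀ (L : List A) k {x} → L !! k ≡ just x → k < length L
  !!⇒<length (y ∷ L) zero eq = s≤s z≤n
  !!⇒<length (y ∷ L) (suc k) eq = s≤s (!!⇒<length L k eq)

  !!-∷ʳ⁻ : ∀ (L : List A) x k {y} → (L ++ [ x ]) !! k ≡ just y →
           (L !! k ≡ just y) ⊎ ((k ≡ length L) × (y ≡ x))
  !!-∷ʳ⁻ [] x zero refl = inj₂ (refl , refl)
  !!-∷ʳ⁻ (z ∷ L) x zero eq = inj₁ eq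
  !!-∷ʳ⁻ (z ∷ L) x (suc k) eq with !!-∷ʳ⁻ L x k eq
  ... | inj₁ e = inj₁ e
  ... | inj₂ (e , f) = inj₂ (cong suc e , f)

  ∈⇒!! : ∀ {x} (xs : List A) → x ∈ xs → Σ ℕ λ u → xs !! u ≡ just x
  ∈⇒!! (_ ∷ xs) (here refl) = 0 , refl
  ∈⇒!! (_ ∷ xs) (there mem) with ∈⇒!! xs mem
  ... | u , e = suc u , e

  !!⇒∈ : ∀ {x} (xs : List A) u → xs !! u ≡ just x → x ∈ xs
  !!⇒∈ (y ∷ xs) zero refl = here refl
  !!⇒∈ (y ∷ xs) (suc u) e = there (!!⇒∈ xs u e)

  !!-tabulate : ∀ {k} (f : Fin k → A) (g : Fin k) → tabulate f !! toℕ g ≡ just (f g)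
  !!-tabulate f fzero = refl
  !!-tabulate f (fsuc g) = !!-tabulate (λ z → f (fsuc z)) g

  !!-tabulate⁻ : ∀ {k} (f : Fin k → A) j {x} → tabulate f !! j ≡ just x →
                 Σ (Fin k) λ g → (toℕ g ≡ j) × (f g ≡ x)
  !!-tabulate⁻ {k = suc k} f zero refl = fzero , refl , refl
  !!-tabulate⁻ {k = suc k} f (suc j) e with !!-tabulate⁻ (λ z → f (fsuc z)) j e
  ... | g , a , b = fsuc g , cong suc a , b

  index-injective : ∀ {x y : A} xs (p : x ∈ xs) (q : y ∈ xs) → index p ≡ index q → x ≡ y
  index-injective (_ ∷ xs) (here refl) (here refl) _ = refl
  index-injective (_ ∷ xs) (there p) (there q) e = index-injective xs p q (fsuc-injective e)

P≢O : P ≢ O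
P≢O ()

step-preserved : (Q : ℕ → Set) → (∀ t → Q t → Q (suc t)) → ∀ {t t'} → t ≤ t' → Q t → Q t'
step-preserved Q step le = go (≤⇒≤′ le)
  where
  go : ∀ {t t'} → t ≤′ t' → Q t → Q t'
  go ≤′-refl q = q
  go (≤′-step le) q = step _ (go le q)

infinite-path : (B : List Move → Set) → B [] → (∀ x → B x → Σ Move λ m → B (x ++ [ m ])) →
                Σ (ℕ → Move) λ p → ∀ k → B (prefix p k)
infinite-path B B[] next = p , λ k → subst B (sym (prefix≡ k)) (proj₂ (walk k))
  where
  walk : ℕ → Σ (List Move) B
  walk zero = [] , B[]
  walk (suc k) = let (x , bx) = walk k ; (m , bxm) = next x bx in x ++ [ m ] , bxm
  p : ℕ → Move
  p k = proj₁ (next (proj₁ (walk k)) (proj₂ (walk k)))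
  prefix≡ : ∀ k → prefix p k ≡ proj₁ (walk k)
  prefix≡ zero = refl
  prefix≡ (suc k) = cong (_++ [ p k ]) (prefix≡ k)

module Games (𝒫 : ParSig) where
  open ParSig 𝒫
  open WithPar 𝒫

  pl-injective : ∀ {x y} → pl x ≡ pl y → x ≡ y
  pl-injective refl = refl

  PosFrom-∷ʳ : ∀ G z y m → PosFrom G z y → m ∈E kids G (z ++ y) → PosFrom G z (y ++ [ m ])
  PosFrom-∷ʳ G z [] m _ k = subst (λ w → m ∈E kids G w) (++-identityʳ z) k , tt
  PosFrom-∷ʳ G z (x ∷ y) m (a , b) k = a , PosFrom-∷ʳ G (z ++ [ x ]) y m b
    (subst (λ w → m ∈E kids G w) (sym (++-assoc z [ x ] y)) k)

  PosFrom-∷ʳ⁻ : ∀ G z y m → PosFrom G z (y ++ [ m ]) → PosFrom G z y × (m ∈E kids G (z ++ y))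
  PosFrom-∷ʳ⁻ G z [] m (k , _) = tt , subst (λ w → m ∈E kids G w) (sym (++-identityʳ z)) k
  PosFrom-∷ʳ⁻ G z (x ∷ y) m (a , b) with PosFrom-∷ʳ⁻ G (z ++ [ x ]) y m b
  ... | p , k = (a , p) , subst (λ w → m ∈E kids G w) (++-assoc z [ x ] y) k

  Pos-∷ʳ : ∀ G y m → Pos G y → m ∈E kids G y → Pos G (y ++ [ m ])
  Pos-∷ʳ G = PosFrom-∷ʳ G []

  Pos-∷ʳ⁻ : ∀ G y m → Pos G (y ++ [ m ]) → m ∈E kids G y
  Pos-∷ʳ⁻ G y m p = proj₂ (PosFrom-∷ʳ⁻ G [] y m p)

  PosFrom-assignG : ∀ G J η z y → PosFrom (assignG J η G) z y ≡ PosFrom G z y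
  PosFrom-assignG G J η z [] = refl
  PosFrom-assignG G J η z (m ∷ y) = cong ((m ∈E kids G z) ×_) (PosFrom-assignG G J η (z ++ [ m ]) y)

  Pos-assignG⁺ : ∀ G J η y → Pos G y → Pos (assignG J η G) y
  Pos-assignG⁺ G J η y = subst (λ X → X) (sym (PosFrom-assignG G J η [] y))

  Pos-assignG⁻ : ∀ G J η y → Pos (assignG J η G) y → Pos G y
  Pos-assignG⁻ G J η y = subst (λ X → X) (PosFrom-assignG G J η [] y)

  ∉E-fin[] : ∀ {m} → ¬ (m ∈E fin [])
  ∉E-fin[] ()

  leaf⇒kids≡[] : ∀ G y → Pos G y → (∀ m → ¬ Pos G (y ++ [ m ])) → kids G y ≡ fin []
  leaf⇒kids≡[] G y p nl with kids G y in e
  ... | fin [] = refl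
  ... | fin (m ∷ _) = ⊥-elim (nl m (Pos-∷ʳ G y m p (subst (m ∈E_) (sym e) (here refl))))
  ... | inf f = ⊥-elim (nl (f 0) (Pos-∷ʳ G y (f 0) p (subst (f 0 ∈E_) (sym e) (0 , refl))))

  winning-exclusive : ExcludedMiddle (Level.suc 0ℓ) → (A : Arena) {σ τ : List Move → Set} →
                      IsGWinning A O σ → IsGWinning A P τ → ⊥
  winning-exclusive em A {σ} {τ}
    (((((σpos , σ[] , _) , σopp) , σtot) , σleaf) , σinf)
    (((((τpos , τ[] , _) , τopp) , τtot) , τleaf) , τinf)
    with infinite-path (λ x → σ x × τ x) (σ[] , τ[]) next
    where
    next : ∀ x → σ x × τ x → Σ Move λ m → σ (x ++ [ m ]) × τ (x ++ [ m ])
    next x (sx , tx) with decide em (NonLeaf A x)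
    ... | no ¬nl with () ← trans (sym (τleaf x tx (τpos x tx , λ m p → ¬nl (m , p))))
                                 (σleaf x sx (τpos x tx , λ m p → ¬nl (m , p)))
    ... | yes nl with Aturn A x in eq
    ... | P = let (m , tm) = τtot x tx nl eq in m , σopp x sx nl eq m (τpos _ tm) , tm
    ... | O = let (m , sm) = σtot x sx nl eq in m , sm , τopp x tx nl eq m (σpos _ sm)
  ... | p , both = σinf p (λ k → proj₁ (both k)) (τinf p (λ k → proj₂ (both k)))

  not-winning⇒losing-play : ExcludedMiddle (Level.suc 0ℓ) → (A : Arena) {g : Player} {σ : List Move → Set} →
    IsGTotal A g σ → ¬ IsGWinning A g σ →
    (Σ (List Move) λ x → σ x × Leaf A x × Awin A x ≢ pl g) ⊎
    (Σ (ℕ → Move) λ p → (∀ k → σ (prefix p k)) × ¬ InfWin A g p)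
  not-winning⇒losing-play em A {g} {σ} total ¬win
    with decide em (Σ (List Move) λ x → σ x × Leaf A x × Awin A x ≢ pl g)
  ... | yes finite = inj₁ finite
  ... | no ¬finite with decide em (Σ (ℕ → Move) λ p → (∀ k → σ (prefix p k)) × ¬ InfWin A g p)
  ... | yes infinite = inj₂ infinite
  ... | no ¬infinite = ⊥-elim (¬win ((total , leaves) , plays))
    where
    leaves : ∀ x → σ x → Leaf A x → Awin A x ≡ pl g
    leaves x h lf with decide em (Awin A x ≡ pl g)
    ... | yes e = e
    ... | no ne = ⊥-elim (¬finite (x , h , lf , ne))
    plays : ∀ p → (∀ k → σ (prefix p k)) → InfWin A g p
    plays p h with decide em (InfWin A g p)
    ... | yes w = w
    ... | no ¬w = ⊥-elim (¬infinite (p , h , ¬w))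

==ℕ-refl : ∀ a → (a ==ℕ a) ≡ true
==ℕ-refl zero = refl
==ℕ-refl (suc a) = ==ℕ-refl a

==ℕ-sound : ∀ a b → (a ==ℕ b) ≡ true → a ≡ b
==ℕ-sound zero zero _ = refl
==ℕ-sound (suc a) (suc b) e = cong suc (==ℕ-sound a b e)

∧-true⁻ : ∀ {a b} → a ∧ b ≡ true → (a ≡ true) × (b ≡ true)
∧-true⁻ {true} {true} _ = refl , refl

∨-true⁻ : ∀ {a b} → a ∨ b ≡ true → (a ≡ true) ⊎ (b ≡ true)
∨-true⁻ {true} _ = inj₁ refl
∨-true⁻ {false} e = inj₂ e

JUST-injective : ∀ {a b c d} → JUST a b ≡ JUST c d → (a ≡ c) × (b ≡ d)
JUST-injective refl = refl , refl

==M-refl : ∀ m → (m ==M m) ≡ true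
==M-refl (DROP a) = ==ℕ-refl a
==M-refl (EM a b) rewrite ==ℕ-refl a | ==ℕ-refl b = refl
==M-refl (STOP a) = ==ℕ-refl a
==M-refl (JUST a b) rewrite ==ℕ-refl a | ==ℕ-refl b = refl
==M-refl (nth a) = ==ℕ-refl a

==M-sound : ∀ m m' → (m ==M m') ≡ true → m ≡ m'
==M-sound (DROP a) (DROP b) e = cong DROP (==ℕ-sound a b e)
==M-sound (EM a b) (EM a' b') e with e₁ , e₂ ← ∧-true⁻ e = cong₂ EM (==ℕ-sound a a' e₁) (==ℕ-sound b b' e₂)
==M-sound (STOP a) (STOP b) e = cong STOP (==ℕ-sound a b e)
==M-sound (JUST a b) (JUST a' b') e with e₁ , e₂ ← ∧-true⁻ e = cong₂ JUST (==ℕ-sound a a' e₁) (==ℕ-sound b b' e₂)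
==M-sound (nth a) (nth b) e = cong nth (==ℕ-sound a b e)
==M-sound (DROP _) (EM _ _) ()
==M-sound (DROP _) (STOP _) ()
==M-sound (DROP _) (JUST _ _) ()
==M-sound (DROP _) (nth _) ()
==M-sound (EM _ _) (DROP _) ()
==M-sound (EM _ _) (STOP _) ()
==M-sound (EM _ _) (JUST _ _) ()
==M-sound (EM _ _) (nth _) ()
==M-sound (STOP _) (DROP _) ()
==M-sound (STOP _) (EM _ _) ()
==M-sound (STOP _) (JUST _ _) ()
==M-sound (STOP _) (nth _) ()
==M-sound (JUST _ _) (DROP _) ()
==M-sound (JUST _ _) (EM _ _) ()
==M-sound (JUST _ _) (STOP _) ()
==M-sound (JUST _ _) (nth _) ()
==M-sound (nth _) (DROP _) ()
==M-sound (nth _) (EM _ _) ()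
==M-sound (nth _) (STOP _) ()
==M-sound (nth _) (JUST _ _) ()

module ForallGame (𝒫 : ParSig) (n : ℕ) (Γ : Fin n → WithPar.Game 𝒫) (I : ParSig.Par 𝒫 → Bool) where
  open ParSig 𝒫
  open WithPar 𝒫
  open Forall n Γ I
  open Games 𝒫

  ==L-refl : ∀ x → (x ==L x) ≡ true
  ==L-refl (pl P) = refl
  ==L-refl (pl O) = refl
  ==L-refl (par a) with a ≟ a
  ... | yes _ = refl
  ... | no ne = ⊥-elim (ne refl)

  ==L-sound : ∀ x y → (x ==L y) ≡ true → x ≡ y
  ==L-sound (pl P) (pl P) _ = refl
  ==L-sound (pl O) (pl O) _ = refl
  ==L-sound (par a) (par b) e with a ≟ b
  ... | yes refl = refl
  ==L-sound (par a) (par b) () | no _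
  ==L-sound (pl P) (pl O) ()
  ==L-sound (pl O) (pl P) ()
  ==L-sound (pl P) (par _) ()
  ==L-sound (pl O) (par _) ()
  ==L-sound (par _) (pl _) ()

  isEmptyE⇒≡[] : ∀ e → isEmptyE e ≡ true → e ≡ fin []
  isEmptyE⇒≡[] (fin []) _ = refl

  ≢[]⇒¬isEmptyE : ∀ e → e ≢ fin [] → isEmptyE e ≡ false
  ≢[]⇒¬isEmptyE (fin []) ne = ⊥-elim (ne refl)
  ≢[]⇒¬isEmptyE (fin (x ∷ xs)) ne = refl
  ≢[]⇒¬isEmptyE (inf f) ne = refl

  ¬isEmptyE⇒≢[] : ∀ e → isEmptyE e ≡ false → e ≢ fin []
  ¬isEmptyE⇒≢[] (fin []) () refl

  ∈E⇒¬isEmptyE : ∀ e m → m ∈E e → isEmptyE e ≡ false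
  ∈E⇒¬isEmptyE (fin (x ∷ xs)) m _ = refl
  ∈E⇒¬isEmptyE (inf f) m _ = refl

  ¬isEmptyE⇒∈E : ∀ e → isEmptyE e ≡ false → Σ Move λ m → m ∈E e
  ¬isEmptyE⇒∈E (fin (x ∷ xs)) _ = x , here refl
  ¬isEmptyE⇒∈E (inf f) _ = f 0 , 0 , refl

  isENDb-sound : ∀ L j x → isENDb L j x ≡ true → IsEND L j x
  isENDb-sound L j x e with L !! j
  ... | just l with ∧-true⁻ e
  ... | e₁ , e₂ = l , refl , isEmptyE⇒≡[] _ e₁ , ==L-sound _ _ e₂

  isENDb-complete : ∀ L j x → IsEND L j x → isENDb L j x ≡ true
  isENDb-complete L j x (l , e₁ , e₂ , e₃) rewrite e₁ | e₂ | e₃ = ==L-refl x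

  findEND-just : ∀ L x k j {j'} → findEND L x k j ≡ just j' → (isENDb L j' x ≡ true) × (j' < k + j)
  findEND-just L x (suc k) j {j'} e with isENDb L j x in e₁
  ... | true with refl ← e = e₁ , s≤s (m≤n+m j k)
  ... | false with findEND-just L x k (suc j) e
  ... | a , b = a , subst (j' <_) (+-suc k j) b

  findEND-nothing : ∀ L x k j j' → findEND L x k j ≡ nothing → isENDb L j' x ≡ true → j ≤ j' → j' < k + j → ⊥
  findEND-nothing L x zero j j' e b j≤j' j'< = ≤⇒≯ j≤j' j'<
  findEND-nothing L x (suc k) j j' e b j≤j' j'< with isENDb L j x in e₁
  ... | true with () ← e
  ... | false with m≤n⇒m<n∨m≡n j≤j'
  ... | inj₁ j<j' = findEND-nothing L x k (suc j) j' e b j<j' (subst (j' <_) (sym (+-suc k j)) j'<)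
  ... | inj₂ refl with () ← trans (sym e₁) b

  inJ-sound : ∀ i m J → inJ i m J ≡ true → Σ ℕ λ q → (i , m , q) ∈ J
  inJ-sound i m ((i' , m' , q') ∷ J) e with ∨-true⁻ {(i' ==ℕ i) ∧ (m' ==M m)} e
  ... | inj₁ e' with ==ℕ-sound i' i (proj₁ (∧-true⁻ e')) | ==M-sound m' m (proj₂ (∧-true⁻ e'))
  ... | refl | refl = q' , here refl
  inJ-sound i m (_ ∷ J) e | inj₂ e' with inJ-sound i m J e'
  ... | q , mem = q , there mem

  inJ-complete : ∀ i m J q → (i , m , q) ∈ J → inJ i m J ≡ true
  inJ-complete i m (_ ∷ J) q (here refl) rewrite ==ℕ-refl i | ==M-refl m = refl
  inJ-complete i m ((i' , m' , q') ∷ J) q (there mem) rewrite inJ-complete i m J q mem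
    with (i' ==ℕ i) ∧ (m' ==M m)
  ... | true = refl
  ... | false = refl

  hasI-sound : ∀ i J → hasI i J ≡ true → Σ Move λ m → Σ ℕ λ q → (i , m , q) ∈ J
  hasI-sound i ((i' , m' , q') ∷ J) e with ∨-true⁻ {i' ==ℕ i} e
  ... | inj₁ e' with ==ℕ-sound i' i e'
  ... | refl = m' , q' , here refl
  hasI-sound i (_ ∷ J) e | inj₂ e' with hasI-sound i J e'
  ... | m , q , mem = m , q , there mem

  hasI-complete : ∀ i m q J → (i , m , q) ∈ J → hasI i J ≡ true
  hasI-complete i m q (_ ∷ J) (here refl) rewrite ==ℕ-refl i = refl
  hasI-complete i m q ((i' , _ , _) ∷ J) (there mem) rewrite hasI-complete i m q J mem with i' ==ℕ i
  ... | true = refl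
  ... | false = refl

  ¬hasI⇒¬inJ : ∀ j m J → hasI j J ≡ false → inJ j m J ≡ false
  ¬hasI⇒¬inJ j m J h with inJ j m J in e
  ... | false = refl
  ... | true with q , mem ← inJ-sound j m J e with () ← trans (sym h) (hasI-complete j m q J mem)

  entry : Enum → ℕ → Maybe Move
  entry (fin xs) u = xs !! u
  entry (inf f) u = just (f u)

  ∈E⇒entry : ∀ {m} e → m ∈E e → Σ ℕ λ u → entry e u ≡ just m
  ∈E⇒entry (fin xs) mem = ∈⇒!! xs mem
  ∈E⇒entry (inf f) (t , refl) = t , refl

  entry⇒∈E : ∀ {m} e u → entry e u ≡ just m → m ∈E e
  entry⇒∈E (fin xs) u e = !!⇒∈ xs u e
  entry⇒∈E (inf f) u refl = u , refl

  FirstFree : ℕ → Triples → Enum → Move → Set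
  FirstFree i J e m = Σ ℕ λ u → (entry e u ≡ just m) × (inJ i m J ≡ false) ×
    (∀ u' m' → u' < u → entry e u' ≡ just m' → inJ i m' J ≡ true)

  firstFreeList-just : ∀ i J xs {m} → firstFreeList i J xs ≡ just m → FirstFree i J (fin xs) m
  firstFreeList-just i J (x ∷ xs) e with inJ i x J in e₁
  ... | false with refl ← e = 0 , refl , e₁ , λ { u' m' () _ }
  ... | true with u , a , b , c ← firstFreeList-just i J xs e = suc u , a , b , earlier
    where
    earlier : ∀ u' m' → u' < suc u → (x ∷ xs) !! u' ≡ just m' → inJ i m' J ≡ true
    earlier zero m' _ refl = e₁
    earlier (suc u') m' (s≤s lt) eq = c u' m' lt eq

  firstFreeSeq-just : ∀ i J f k t {m} → firstFreeSeq i J f k t ≡ just m →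
                      Σ ℕ λ u → (f u ≡ m) × (inJ i m J ≡ false) ×
                                (∀ u' → t ≤ u' → u' < u → inJ i (f u') J ≡ true)
  firstFreeSeq-just i J f (suc k) t e with inJ i (f t) J in e₁
  ... | false with refl ← e = t , refl , e₁ , λ u' a b → ⊥-elim (≤⇒≯ a b)
  ... | true with u , a , b , c ← firstFreeSeq-just i J f k (suc t) e = u , a , b , earlier
    where
    earlier : ∀ u' → t ≤ u' → u' < u → inJ i (f u') J ≡ true
    earlier u' t≤u' u'<u with m≤n⇒m<n∨m≡n t≤u'
    ... | inj₁ t<u' = c u' t<u' u'<u
    ... | inj₂ refl = e₁

  firstFree-just : ∀ i J e {m} → firstFree i J e ≡ just m → FirstFree i J e m
  firstFree-just i J (fin xs) eq = firstFreeList-just i J xs eq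
  firstFree-just i J (inf f) eq with u , refl , b , c ← firstFreeSeq-just i J f (suc (length J)) 0 eq =
    u , refl , b , λ u' m' lt eq' → subst (λ z → inJ i z J ≡ true) (just-injective eq') (c u' z≤n lt)

  firstFree-∈E : ∀ j J e {m} → firstFree j J e ≡ just m → m ∈E e
  firstFree-∈E j J e eq with u , a , _ ← firstFree-just j J e eq = entry⇒∈E e u a

  firstFree-fresh : ∀ j J e {m} → firstFree j J e ≡ just m → inJ j m J ≡ false
  firstFree-fresh j J e eq = proj₁ (proj₂ (proj₂ (firstFree-just j J e eq)))

  firstFreeList-nothing : ∀ i J xs → firstFreeList i J xs ≡ nothing →
                          ∀ u m → xs !! u ≡ just m → inJ i m J ≡ true
  firstFreeList-nothing i J (x ∷ xs) e u m eq with inJ i x J in e₁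
  firstFreeList-nothing i J (x ∷ xs) e zero m refl | true = e₁
  firstFreeList-nothing i J (x ∷ xs) e (suc u) m eq | true = firstFreeList-nothing i J xs e u m eq

  firstFreeSeq-nothing : ∀ i J f k t → firstFreeSeq i J f k t ≡ nothing →
                         ∀ u → t ≤ u → u < k + t → inJ i (f u) J ≡ true
  firstFreeSeq-nothing i J f zero t e u a b = ⊥-elim (≤⇒≯ a b)
  firstFreeSeq-nothing i J f (suc k) t e u a b with inJ i (f t) J in e₁
  ... | true with m≤n⇒m<n∨m≡n a
  ... | inj₁ t<u = firstFreeSeq-nothing i J f k (suc t) e u t<u (subst (u <_) (sym (+-suc k t)) b)
  ... | inj₂ refl = e₁

  firstFree-nothing-entry : ∀ k J e u {m} → firstFree k J e ≡ nothing → entry e u ≡ just m → u ≤ length J →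
                            inJ k m J ≡ true
  firstFree-nothing-entry k J (fin xs) u eq e _ = firstFreeList-nothing k J xs eq u _ e
  firstFree-nothing-entry k J (inf f) u eq refl le =
    firstFreeSeq-nothing k J f (suc (length J)) 0 eq u z≤n (s≤s (subst (u ≤_) (sym (+-identityʳ _)) le))

  -- Pigeonhole: the |J| + 1 entries would need pairwise distinct triples in J.
  injective-escapes : ∀ k (J : Triples) (f : ℕ → Move) → Injective _≡_ _≡_ f →
                      ¬ (∀ u → u ≤ length J → inJ k (f u) J ≡ true)
  injective-escapes k J f f-inj all =
    let (u , u' , u<u' , eq) = pigeonhole (n<1+n (length J)) position
    in <-irrefl (f-inj (proj₁ (,-injective (proj₂ (,-injective (index-injective J _ _ eq)))))) u<u'
    where
    position : Fin (suc (length J)) → Fin (length J)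
    position u = index (proj₂ (inJ-sound k (f (toℕ u)) J (all (toℕ u) (≤-pred (toℕ<n u)))))

  firstFree-nothing-∈E : ∀ k J e m → firstFree k J e ≡ nothing → m ∈E e →
                         (∀ f → e ≡ inf f → Injective _≡_ _≡_ f) → inJ k m J ≡ true
  firstFree-nothing-∈E k J (fin xs) m eq mem _ with u , e ← ∈⇒!! xs mem = firstFreeList-nothing k J xs eq u m e
  firstFree-nothing-∈E k J (inf f) m eq mem inj =
    ⊥-elim (injective-escapes k J f (inj f refl) λ u le → firstFree-nothing-entry k J (inf f) u eq refl le)

  -- The local function clause of scan, restated so that it can be named.
  clauseOf : List Loc → Triples → ℕ → ℕ → Loc → Bool → Label → Player → Maybe Act
  clauseOf L J c i l true (par a) _ with I a
  ... | false = nothing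
  ... | true with findEND L (par (dual a)) c 0
  ...   | just j  = just (leafMove (EM i j))
  ...   | nothing = nothing
  clauseOf L J c i l true (pl P) _ = just (leafMove (STOP i))
  clauseOf L J c i l true (pl O) _ = nothing
  clauseOf L J c i l false _ P with firstFree i J (kidsL l)
  ... | just m  = just (justP i l m c)
  ... | nothing = nothing
  clauseOf L J c i l false _ O = if hasI i J then nothing else just (justO i l c)

  clauseAt : List Loc → Triples → ℕ → ℕ → Maybe Act
  clauseAt L J c i with L !! i
  ... | nothing = nothing
  ... | just l = clauseOf L J c i l (isEmptyE (kidsL l)) (winL l) (turnL l)

  clauseAt-≡ : ∀ L J c j {l} → L !! j ≡ just l →
               clauseAt L J c j ≡ clauseOf L J c j l (isEmptyE (kidsL l)) (winL l) (turnL l)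
  clauseAt-≡ L J c j e rewrite e = refl

  scan-suc : ∀ L J c k i → scan L J c (suc k) i ≡ (clauseAt L J c i <∣> scan L J c k (suc i))
  scan-suc L J c k i with L !! i
  ... | nothing = refl
  ... | just l with isEmptyE (kidsL l) | winL l | turnL l
  ... | true | par a | _ with I a
  ... | false = refl
  ... | true with findEND L (par (dual a)) c 0
  ... | just j = refl
  ... | nothing = refl
  scan-suc L J c k i | just l | true | pl P | _ = refl
  scan-suc L J c k i | just l | true | pl O | _ = refl
  scan-suc L J c k i | just l | false | _ | P with firstFree i J (kidsL l)
  ... | just m = refl
  ... | nothing = refl
  scan-suc L J c k i | just l | false | _ | O with hasI i J
  ... | true = refl
  ... | false = refl

  data Skips (L : List Loc) (J : Triples) (c j : ℕ) : Set where
    skips : clauseAt L J c j ≡ nothing → Skips L J c j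

  skipped : ∀ {L J c j} → Skips L J c j → clauseAt L J c j ≡ nothing
  skipped (skips e) = e

  data ScanResult (L : List Loc) (J : Triples) (c r i : ℕ) : Maybe Act → Set where
    found : ∀ j {a} → i ≤ j → j < r + i → clauseAt L J c j ≡ just a →
            (∀ j' → i ≤ j' → j' < j → Skips L J c j') → ScanResult L J c r i (just a)
    none : (∀ j → i ≤ j → j < r + i → Skips L J c j) → ScanResult L J c r i nothing

  scan-spec : ∀ L J c r i → ScanResult L J c r i (scan L J c r i)
  scan-spec L J c zero i = none (λ j i≤j j<i → ⊥-elim (≤⇒≯ i≤j j<i))
  scan-spec L J c (suc r) i rewrite scan-suc L J c r i with clauseAt L J c i in e
  ... | just a = found i ≤-refl (s≤s (m≤n+m i r)) e (λ j' i≤j' j'<i → ⊥-elim (≤⇒≯ i≤j' j'<i))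
  ... | nothing with scan L J c r (suc i) | scan-spec L J c r (suc i)
  ... | just a | found j si≤j j<r+si cl sk =
        found j (≤-trans (n≤1+n i) si≤j) (subst (j <_) (+-suc r i) j<r+si) cl earlier
    where
    earlier : ∀ j' → i ≤ j' → j' < j → Skips L J c j'
    earlier j' i≤j' j'<j with m≤n⇒m<n∨m≡n i≤j'
    ... | inj₁ i<j' = sk j' i<j' j'<j
    ... | inj₂ refl = skips e
  ... | nothing | none sk = none all
    where
    all : ∀ j' → i ≤ j' → j' < suc r + i → Skips L J c j'
    all j' i≤j' j'<r with m≤n⇒m<n∨m≡n i≤j'
    ... | inj₁ i<j' = sk j' i<j' (subst (j' <_) (sym (+-suc r i)) j'<r)
    ... | inj₂ refl = skips e

  round-skips : ∀ {L J i c} → i ≤ c → (∀ j → i ≤ j → j < c ∸ i + i → Skips L J c j) →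
          ∀ j → i ≤ j → j < c → Skips L J c j
  round-skips i≤c sk j a b = sk j a (subst (j <_) (sym (m∸n+n≡m i≤c)) b)

  data ExhView (L : List Loc) (i c : ℕ) (J : Triples) : Act → Set where
    inRound : ∀ j {a} → i ≤ j → j < c → clauseAt L J c j ≡ just a →
            (∀ j' → i ≤ j' → j' < j → Skips L J c j') → ExhView L i c J a
    newRound : (∀ j → i ≤ j → j < c → Skips L J c j) → c < length L →
             ∀ j {a} → j < length L → clauseAt L J (length L) j ≡ just a →
             (∀ j' → j' < j → Skips L J (length L) j') → ExhView L i c J a
    dropExhausted : (∀ j → i ≤ j → j < c → Skips L J c j) → ¬ (c < length L) →
            ExhView L i c J (leafMove (DROP (length L)))
    dropRepeated : (∀ j → i ≤ j → j < c → Skips L J c j) → c < length L →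
            (∀ j → j < length L → Skips L J (length L) j) →
            ExhView L i c J (leafMove (DROP (length L)))

  exhView : ∀ L i c J → i ≤ c → ExhView L i c J (exhAct L i c J)
  exhView L i c J i≤c with scan L J c (c ∸ i) i | scan-spec L J c (c ∸ i) i
  ... | just a | found j i≤j j< cl sk = inRound j i≤j (subst (j <_) (m∸n+n≡m i≤c) j<) cl sk
  ... | nothing | none sk₁ with c <ᵇ length L in eb
  ... | false = dropExhausted (round-skips {L} {J} i≤c sk₁) (λ lt → subst T eb (<⇒<ᵇ lt))
  ... | true with c<L ← <ᵇ⇒< c (length L) (subst T (sym eb) tt)
               with scan L J (length L) (length L) 0 | scan-spec L J (length L) (length L) 0
  ...   | just a | found j _ j< cl sk =
          newRound (round-skips {L} {J} i≤c sk₁) c<L j (subst (j <_) (+-identityʳ _) j<) cl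
                   (λ j' lt → sk j' z≤n lt)
  ...   | nothing | none sk₂ =
          dropRepeated (round-skips {L} {J} i≤c sk₁) c<L
                       (λ j lt → sk₂ j z≤n (subst (j <_) (sym (+-identityʳ _)) lt))

  data Fires (L : List Loc) (J : Triples) (c j : ℕ) : Act → Set where
    fireEM : ∀ l a j' → L !! j ≡ just l → kidsL l ≡ fin [] → winL l ≡ par a → I a ≡ true →
             findEND L (par (dual a)) c 0 ≡ just j' → Fires L J c j (leafMove (EM j j'))
    fireSTOP : ∀ l → L !! j ≡ just l → kidsL l ≡ fin [] → winL l ≡ pl P → Fires L J c j (leafMove (STOP j))
    fireP : ∀ l m → L !! j ≡ just l → isEmptyE (kidsL l) ≡ false → turnL l ≡ P →
            firstFree j J (kidsL l) ≡ just m → Fires L J c j (justP j l m c)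
    fireO : ∀ l → L !! j ≡ just l → isEmptyE (kidsL l) ≡ false → turnL l ≡ O →
            hasI j J ≡ false → Fires L J c j (justO j l c)

  clauseAt-fires : ∀ L J c j {a} → clauseAt L J c j ≡ just a → Fires L J c j a
  clauseAt-fires L J c j eq with L !! j in e₁
  ... | just l with isEmptyE (kidsL l) in e₂ | winL l in e₃ | turnL l in e₄
  ... | true | par a | _ with I a in e₅
  ... | true with findEND L (par (dual a)) c 0 in e₆
  ... | just j' with refl ← eq = fireEM l a j' e₁ (isEmptyE⇒≡[] _ e₂) e₃ e₅ e₆
  clauseAt-fires L J c j eq | just l | true | pl P | _ with refl ← eq = fireSTOP l e₁ (isEmptyE⇒≡[] _ e₂) e₃
  clauseAt-fires L J c j eq | just l | false | _ | P with firstFree j J (kidsL l) in e₅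
  ... | just m with refl ← eq = fireP l m e₁ e₂ e₄ e₅
  clauseAt-fires L J c j eq | just l | false | _ | O with hasI j J in e₅
  ... | false with refl ← eq = fireO l e₁ e₂ e₄ e₅

  module _ {L J c j l} (sk : Skips L J c j) (e₁ : L !! j ≡ just l) where

    Skips⇒firstFree≡nothing : isEmptyE (kidsL l) ≡ false → turnL l ≡ P → firstFree j J (kidsL l) ≡ nothing
    Skips⇒firstFree≡nothing e₂ e₄ with trans (sym (clauseAt-≡ L J c j e₁)) (skipped sk)
    ... | sk' rewrite e₂ | e₄ with firstFree j J (kidsL l)
    ... | nothing = refl
    ... | just m with () ← sk'

    Skips⇒hasI : isEmptyE (kidsL l) ≡ false → turnL l ≡ O → hasI j J ≡ true
    Skips⇒hasI e₂ e₄ with trans (sym (clauseAt-≡ L J c j e₁)) (skipped sk)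
    ... | sk' rewrite e₂ | e₄ with hasI j J
    ... | true = refl
    ... | false with () ← sk'

    Skips⇒¬winP : kidsL l ≡ fin [] → winL l ≢ pl P
    Skips⇒¬winP e₂ e₃ with trans (sym (clauseAt-≡ L J c j e₁)) (skipped sk)
    ... | sk' rewrite e₂ | e₃ with () ← sk'

    Skips⇒findEND≡nothing : ∀ {a} → kidsL l ≡ fin [] → winL l ≡ par a → I a ≡ true →
                            findEND L (par (dual a)) c 0 ≡ nothing
    Skips⇒findEND≡nothing {a} e₂ e₃ e₅ with trans (sym (clauseAt-≡ L J c j e₁)) (skipped sk)
    ... | sk' rewrite e₂ | e₃ | e₅ with findEND L (par (dual a)) c 0
    ... | nothing = refl
    ... | just _ with () ← sk'


  record ExhState : Set where
    constructor st
    field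
      L : List Loc
      i c : ℕ
      J : Triples
  open ExhState public

  InExhAt : ExhState → List Move → Set
  InExhAt S = InExh (L S) (i S) (c S) (J S)

  descend : ExhState → ℕ → Loc → Move → ℕ → ExhState
  descend S j l m c' = st (extendL (L S) l m) (suc j) c' (J S ++ [ (j , m , length (L S)) ])

  advance : ExhState → Act → Move → ExhState
  advance S (leafMove _) m = S
  advance S (justP j l m' c') m = descend S j l m' c'
  advance S (justO j l c') m = descend S j l m c'

  next : ExhState → Move → ExhState
  next S m = advance S (exhAct (L S) (i S) (c S) (J S)) m

  InExhAt-next : ∀ S a m ys → InExhAt S (a ∷ m ∷ ys) → InExhAt (next S m) ys
  InExhAt-next S a m ys h with exhAct (L S) (i S) (c S) (J S)
  ... | justP j l m' c' = proj₂ (proj₂ h)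
  ... | justO j l c' = proj₂ (proj₂ h)

  WellShaped : ExhState → Set
  WellShaped S = (i S ≤ c S) × (c S ≤ length (L S)) × (((i S ≡ 0) × (c S ≡ length (L S))) ⊎ (c S < length (L S)))

  data ExhAction (S : ExhState) : Act → Set where
    actEM : ∀ j j' → Legal (atP (L S)) (EM j j') → ExhAction S (leafMove (EM j j'))
    actSTOP : ∀ j l → L S !! j ≡ just l → Legal (atP (L S)) (STOP j) → winL l ≡ pl P →
              ExhAction S (leafMove (STOP j))
    actDROP : (∀ j → j < length (L S) → Skips (L S) (J S) (length (L S)) j) → ExhAction S (leafMove (DROP (length (L S))))
    actP : ∀ j l m c' → L S !! j ≡ just l → isEmptyE (kidsL l) ≡ false → turnL l ≡ P →
          firstFree j (J S) (kidsL l) ≡ just m → suc j ≤ c' → c' ≤ length (L S) → ExhAction S (justP j l m c')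
    actO : ∀ j l c' → L S !! j ≡ just l → isEmptyE (kidsL l) ≡ false → turnL l ≡ O →
          hasI j (J S) ≡ false → suc j ≤ c' → c' ≤ length (L S) → ExhAction S (justO j l c')

  fires⇒ExhAction : ∀ S c' j {a} → Fires (L S) (J S) c' j a → j < c' → c' ≤ length (L S) → ExhAction S a
  fires⇒ExhAction S c' j (fireEM l a j' e₁ e₂ e₃ e₅ e₆) _ _ =
    actEM j j' (a , (l , e₁ , e₂ , e₃) , isENDb-sound (L S) j' _ (proj₁ (findEND-just (L S) _ c' 0 e₆)) , e₅)
  fires⇒ExhAction S c' j (fireSTOP l e₁ e₂ e₃) _ _ = actSTOP j l e₁ (pl P , (l , e₁ , e₂ , e₃) , tt) e₃
  fires⇒ExhAction S c' j (fireP l m e₁ e₂ e₄ e₅) lt le = actP j l m c' e₁ e₂ e₄ e₅ lt le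
  fires⇒ExhAction S c' j (fireO l e₁ e₂ e₄ e₅) lt le = actO j l c' e₁ e₂ e₄ e₅ lt le

  exhAction : ∀ S → WellShaped S → ExhAction S (exhAct (L S) (i S) (c S) (J S))
  exhAction S (i≤c , c≤L , sh) with exhAct (L S) (i S) (c S) (J S) | exhView (L S) (i S) (c S) (J S) i≤c
  ... | _ | inRound j _ j<c cl _ = fires⇒ExhAction S (c S) j (clauseAt-fires _ _ _ _ cl) j<c c≤L
  ... | _ | newRound _ _ j j<L cl _ = fires⇒ExhAction S (length (L S)) j (clauseAt-fires _ _ _ _ cl) j<L ≤-refl
  ... | _ | dropRepeated _ _ sk = actDROP sk
  ... | _ | dropExhausted sk nlt with sh
  ...   | inj₂ lt = ⊥-elim (nlt lt)
  ...   | inj₁ (i0 , cL) = actDROP λ j lt → subst (λ z → Skips (L S) (J S) z j) cL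
            (sk j (subst (_≤ j) (sym i0) z≤n) (subst (j <_) (sym cL) lt))

  step-JUST : ∀ L j q {l} → L !! j ≡ just l → step (atP L) (JUST j q) ≡ atJ L l
  step-JUST L j q e rewrite e = refl

  step-STOP : ∀ L j {l} → L !! j ≡ just l → step (atP L) (STOP j) ≡ ended (winL l)
  step-STOP L j e rewrite e = refl

  leafMove-ends : ∀ S {mv} → ExhAction S (leafMove mv) → Σ Label λ w → step (atP (L S)) mv ≡ ended w
  leafMove-ends S (actEM j j' _) = pl P , refl
  leafMove-ends S (actSTOP j l e _ _) = winL l , step-STOP (L S) j e
  leafMove-ends S (actDROP _) = pl O , refl

  leafMove-legal : ∀ S {mv} → ExhAction S (leafMove mv) → Legal (atP (L S)) mv
  leafMove-legal S (actEM j j' lg) = lg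
  leafMove-legal S (actSTOP j l e lg _) = lg
  leafMove-legal S (actDROP _) = refl

  descend-WellShaped : ∀ S j l m c' → suc j ≤ c' → c' ≤ length (L S) → WellShaped (descend S j l m c')
  descend-WellShaped S j (g , y) m c' a b rewrite length-∷ʳ (L S) (g , y ++ [ m ]) = a , m≤n⇒m≤1+n b , inj₂ (s≤s b)

  InExhAt⇒valid : ∀ S x → WellShaped S → InExhAt S x → ValidFrom (atP (L S)) x
  InExhAt⇒valid S [] sh h = tt
  InExhAt⇒valid S (a ∷ []) sh h with exhAct (L S) (i S) (c S) (J S) | exhAction S sh
  InExhAt⇒valid S (a ∷ []) sh refl | leafMove mv | w = leafMove-legal S w , tt
  InExhAt⇒valid S (a ∷ []) sh refl | justP j l m c' | actP _ _ _ _ e₁ e₂ _ _ _ _ =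
    (refl , l , e₁ , ¬isEmptyE⇒≢[] _ e₂) , tt
  InExhAt⇒valid S (a ∷ []) sh refl | justO j l c' | actO _ _ _ e₁ e₂ _ _ _ _ =
    (refl , l , e₁ , ¬isEmptyE⇒≢[] _ e₂) , tt
  InExhAt⇒valid S (a ∷ m ∷ ys) sh h with exhAct (L S) (i S) (c S) (J S) | exhAction S sh
  ... | leafMove mv | _ = ⊥-elim h
  ... | justP j l m' c' | actP _ _ _ _ e₁ e₂ _ e₅ lt le with h
  ...   | refl , refl , rest rewrite step-JUST (L S) j (length (L S)) e₁ =
          (refl , l , e₁ , ¬isEmptyE⇒≢[] _ e₂) , firstFree-∈E j (J S) _ e₅ ,
          InExhAt⇒valid (descend S j l m c') ys (descend-WellShaped S j l m c' lt le) rest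
  InExhAt⇒valid S (a ∷ m ∷ ys) sh h | justO j l c' | actO _ _ _ e₁ e₂ _ _ lt le with h
  ...   | refl , mem , rest rewrite step-JUST (L S) j (length (L S)) e₁ =
          (refl , l , e₁ , ¬isEmptyE⇒≢[] _ e₂) , mem ,
          InExhAt⇒valid (descend S j l m c') ys (descend-WellShaped S j l m c' lt le) rest

  InExhAt-prefix : ∀ S x y → InExhAt S (x ++ y) → InExhAt S x
  InExhAt-prefix S [] y h = tt
  InExhAt-prefix S (a ∷ []) [] h = h
  InExhAt-prefix S (a ∷ []) (m ∷ ys) h with exhAct (L S) (i S) (c S) (J S)
  ... | leafMove _ = ⊥-elim h
  ... | justP j l m' c' = proj₁ h
  ... | justO j l c' = proj₁ h
  InExhAt-prefix S (a ∷ m ∷ xs) y h with exhAct (L S) (i S) (c S) (J S)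
  ... | leafMove _ = ⊥-elim h
  ... | justP j l m' c' = proj₁ h , proj₁ (proj₂ h) , InExhAt-prefix (descend S j l m' c') xs y (proj₂ (proj₂ h))
  ... | justO j l c' = proj₁ h , proj₁ (proj₂ h) , InExhAt-prefix (descend S j l m c') xs y (proj₂ (proj₂ h))

  InExhAt-O-closed : ∀ S x → WellShaped S → InExhAt S x → turnS (run (atP (L S)) x) ≡ O → ∀ m →
         ValidFrom (atP (L S)) (x ++ [ m ]) → InExhAt S (x ++ [ m ])
  InExhAt-O-closed S [] sh h () m v
  InExhAt-O-closed S (a ∷ []) sh h t m v with exhAct (L S) (i S) (c S) (J S) | exhAction S sh
  InExhAt-O-closed S (a ∷ []) sh refl t m v | leafMove mv | w with leafMove-ends S w
  ... | w' , e rewrite e = ⊥-elim (P≢O t)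
  InExhAt-O-closed S (a ∷ []) sh refl t m v | justP j l m' c' | actP _ _ _ _ e₁ e₂ e₄ _ _ _
    rewrite step-JUST (L S) j (length (L S)) e₁ = ⊥-elim (P≢O (trans (sym e₄) t))
  InExhAt-O-closed S (a ∷ []) sh refl t m (_ , v , _) | justO j l c' | actO _ _ _ e₁ e₂ _ _ _ _
    rewrite step-JUST (L S) j (length (L S)) e₁ = refl , v , tt
  InExhAt-O-closed S (a ∷ m₁ ∷ xs) sh h t m v with exhAct (L S) (i S) (c S) (J S) | exhAction S sh
  ... | leafMove mv | _ = ⊥-elim h
  ... | justP j l m' c' | actP _ _ _ _ e₁ e₂ _ e₅ lt le with h
  ...   | refl , refl , rest rewrite step-JUST (L S) j (length (L S)) e₁ =
          refl , refl ,
          InExhAt-O-closed (descend S j l m₁ c') xs (descend-WellShaped S j l m₁ c' lt le) rest t m (proj₂ (proj₂ v))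
  InExhAt-O-closed S (a ∷ m₁ ∷ xs) sh h t m v | justO j l c' | actO _ _ _ e₁ e₂ _ _ lt le with h
  ...   | refl , mem , rest rewrite step-JUST (L S) j (length (L S)) e₁ =
          refl , mem ,
          InExhAt-O-closed (descend S j l m₁ c') xs (descend-WellShaped S j l m₁ c' lt le) rest t m (proj₂ (proj₂ v))

  InExhAt-P-total : ∀ S x → WellShaped S → InExhAt S x → (Σ Move λ m → ValidFrom (atP (L S)) (x ++ [ m ])) →
         turnS (run (atP (L S)) x) ≡ P → Σ Move λ m → InExhAt S (x ++ [ m ])
  InExhAt-P-total S [] sh h nl t = firstMove (length (L S)) (exhAct (L S) (i S) (c S) (J S)) , refl
  InExhAt-P-total S (a ∷ []) sh h nl t with exhAct (L S) (i S) (c S) (J S) | exhAction S sh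
  InExhAt-P-total S (a ∷ []) sh refl (m , v) t | leafMove mv | w with leafMove-ends S w
  ... | w' , e rewrite e = ⊥-elim (proj₁ (proj₂ v))
  InExhAt-P-total S (a ∷ []) sh refl nl t | justP j l m' c' | actP _ _ _ _ e₁ e₂ e₄ _ _ _ = m' , refl , refl , tt
  InExhAt-P-total S (a ∷ []) sh refl nl t | justO j l c' | actO _ _ _ e₁ e₂ e₄ _ _ _
    rewrite step-JUST (L S) j (length (L S)) e₁ = ⊥-elim (P≢O (trans (sym t) e₄))
  InExhAt-P-total S (a ∷ m₁ ∷ xs) sh h nl t with exhAct (L S) (i S) (c S) (J S) | exhAction S sh
  ... | leafMove mv | _ = ⊥-elim h
  ... | justP j l m' c' | actP _ _ _ _ e₁ e₂ _ e₅ lt le with h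
  ...   | refl , refl , rest rewrite step-JUST (L S) j (length (L S)) e₁ with
          InExhAt-P-total (descend S j l m₁ c') xs (descend-WellShaped S j l m₁ c' lt le) rest
               (proj₁ nl , proj₂ (proj₂ (proj₂ nl))) t
  ...   | m , r = m , refl , refl , r
  InExhAt-P-total S (a ∷ m₁ ∷ xs) sh h nl t | justO j l c' | actO _ _ _ e₁ e₂ _ _ lt le with h
  ...   | refl , mem , rest rewrite step-JUST (L S) j (length (L S)) e₁ with
          InExhAt-P-total (descend S j l m₁ c') xs (descend-WellShaped S j l m₁ c' lt le) rest
               (proj₁ nl , proj₂ (proj₂ (proj₂ nl))) t
  ...   | m , r = m , refl , mem , r


  initLocs≡tabulate : initLocs ≡ tabulate (λ g → (g , []))
  initLocs≡tabulate = map-tabulate (λ z → z) (λ g → (g , []))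

  initLocs-root : ∀ g → initLocs !! toℕ g ≡ just (g , [])
  initLocs-root g rewrite initLocs≡tabulate = !!-tabulate (λ g → (g , [])) g

  initLocs⁻ : ∀ j g y → initLocs !! j ≡ just (g , y) → (y ≡ []) × (j ≡ toℕ g)
  initLocs⁻ j g y e rewrite initLocs≡tabulate with !!-tabulate⁻ (λ g → (g , [])) j e
  ... | _ , refl , refl = refl , refl

  length-initLocs : length initLocs ≡ n
  length-initLocs rewrite initLocs≡tabulate = length-tabulate (λ g → (g , []))

  extend : Loc → Move → Loc
  extend l m = (proj₁ l , proj₂ l ++ [ m ])

  extend-injective : ∀ l l' m m' → extend l m ≡ extend l' m' → (l ≡ l') × (m ≡ m')
  extend-injective (g , y) (g' , y') m m' e with refl , e₂ ← ,-injective e with refl , refl ← ∷ʳ-injective y y' e₂ =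
    refl , refl

  exh₀ : ExhState
  exh₀ = st initLocs 0 n []

  -- The triple (a, m, q) ∈ J records that the local position q was created as G_a after the move m.
  record Invariant (S : ExhState) : Set where
    field
      wellShaped : WellShaped S
      roots : ∀ g → L S !! toℕ g ≡ just (g , [])
      positions : ∀ k l → L S !! k ≡ just l → Pos (Γ (proj₁ l)) (proj₂ l)
      recorded : ∀ a m q → (a , m , q) ∈ J S →
                 Σ Loc λ l → (L S !! a ≡ just l) × (L S !! q ≡ just (extend l m)) × (a < q)
      origin : ∀ k g y → L S !! k ≡ just (g , y) → ((y ≡ []) × (k ≡ toℕ g)) ⊎
               (Σ ℕ λ a → Σ Move λ m → Σ Loc λ l →
                  ((a , m , k) ∈ J S) × (L S !! a ≡ just l) × ((g , y) ≡ extend l m))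
      distinct : ∀ k k' l → L S !! k ≡ just l → L S !! k' ≡ just l → k ≡ k'
  open Invariant public

  invariant₀ : Invariant exh₀
  invariant₀ = record
    { wellShaped = z≤n , ≤-reflexive (sym length-initLocs) , inj₁ (refl , sym length-initLocs)
    ; roots = initLocs-root
    ; positions = λ k l e → subst (Pos (Γ (proj₁ l))) (sym (proj₁ (initLocs⁻ k (proj₁ l) (proj₂ l) e))) tt
    ; recorded = λ _ _ _ ()
    ; origin = λ k g y e → inj₁ (initLocs⁻ k g y e)
    ; distinct = λ k k' l e e' → trans (proj₂ (initLocs⁻ k (proj₁ l) (proj₂ l) e))
                                       (sym (proj₂ (initLocs⁻ k' (proj₁ l) (proj₂ l) e')))
    }

  descend-Invariant : ∀ S j l m c' → Invariant S → L S !! j ≡ just l → m ∈E kidsL l → inJ j m (J S) ≡ false →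
                      suc j ≤ c' → c' ≤ length (L S) → Invariant (descend S j l m c')
  descend-Invariant S j l m c' iv e₁ mem fresh lt le = record
    { wellShaped = descend-WellShaped S j l m c' lt le
    ; roots = λ g → old (roots iv g)
    ; positions = positions'
    ; recorded = recorded'
    ; origin = origin'
    ; distinct = distinct'
    }
    where
    L' : List Loc
    L' = extendL (L S) l m
    J' : Triples
    J' = J S ++ [ (j , m , length (L S)) ]
    old : ∀ {k x} → L S !! k ≡ just x → L' !! k ≡ just x
    old {k} = !!-++ˡ (L S) _ k
    positions' : ∀ k l₀ → L' !! k ≡ just l₀ → Pos (Γ (proj₁ l₀)) (proj₂ l₀)
    positions' k l₀ e with !!-∷ʳ⁻ (L S) (extend l m) k e
    ... | inj₁ e' = positions iv k l₀ e'
    ... | inj₂ (_ , refl) = Pos-∷ʳ (Γ (proj₁ l)) (proj₂ l) m (positions iv j l e₁) mem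
    recorded' : ∀ a m' q → (a , m' , q) ∈ J' →
                Σ Loc λ l₀ → (L' !! a ≡ just l₀) × (L' !! q ≡ just (extend l₀ m')) × (a < q)
    recorded' a m' q mem' with ∈-++⁻ (J S) mem'
    ... | inj₁ r with l₀ , x , y , z ← recorded iv a m' q r = l₀ , old x , old y , z
    recorded' a m' q mem' | inj₂ (here refl) = l , old e₁ , !!-∷ʳ-length (L S) _ , !!⇒<length (L S) j e₁
    origin' : ∀ k g y → L' !! k ≡ just (g , y) → ((y ≡ []) × (k ≡ toℕ g)) ⊎
              (Σ ℕ λ a → Σ Move λ m' → Σ Loc λ l₀ →
                 ((a , m' , k) ∈ J') × (L' !! a ≡ just l₀) × ((g , y) ≡ extend l₀ m'))
    origin' k g y e with !!-∷ʳ⁻ (L S) (extend l m) k e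
    ... | inj₂ (refl , eq) = inj₂ (j , m , l , ∈-++⁺ʳ (J S) (here refl) , old e₁ , eq)
    ... | inj₁ e' with origin iv k g y e'
    ...   | inj₁ r = inj₁ r
    ...   | inj₂ (a , m' , l₀ , x , y' , z) = inj₂ (a , m' , l₀ , ∈-++⁺ˡ x , old y' , z)
    -- Freshness of m is what keeps the new local position distinct from the old ones.
    new : ∀ k → L S !! k ≢ just (extend l m)
    new k e with origin iv k (proj₁ l) (proj₂ l ++ [ m ]) e
    ... | inj₁ (y≡[] , _) = ∷ʳ≢[] (proj₂ l) y≡[]
    ... | inj₂ (a , m' , l₀ , x , y' , z) with refl , refl ← extend-injective l l₀ m m' z
                                           with refl ← distinct iv a j l y' e₁
                                           with () ← trans (sym fresh) (inJ-complete j m (J S) k x)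
    distinct' : ∀ k k' l₀ → L' !! k ≡ just l₀ → L' !! k' ≡ just l₀ → k ≡ k'
    distinct' k k' l₀ e e' with !!-∷ʳ⁻ (L S) (extend l m) k e | !!-∷ʳ⁻ (L S) (extend l m) k' e'
    ... | inj₁ a | inj₁ b = distinct iv k k' l₀ a b
    ... | inj₂ (refl , refl) | inj₂ (refl , _) = refl
    ... | inj₁ a | inj₂ (_ , refl) = ⊥-elim (new k a)
    ... | inj₂ (_ , refl) | inj₁ b = ⊥-elim (new k' b)

  OWinsUnderAssignment : Set₁
  OWinsUnderAssignment = Σ (Par → Player) λ η → IsAssignment I η ×
    (∀ i → Σ (List Move → Set) λ τ → IsGWinning (gameArena (assignG I η (Γ i))) O τ)

  -- What a play of EXH that P does not win leaves behind: the local positions it visited.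
  record Branch : Set₁ where
    field
      Vis : Fin n → List Move → Set
      root : ∀ g → Vis g []
      valid : ∀ g y → Vis g y → Pos (Γ g) y
      parent : ∀ g y m → Vis g (y ++ [ m ]) → Vis g y
      P-closed : ∀ g y m → Vis g y → turn (Γ g) y ≡ P → m ∈E kids (Γ g) y → Vis g (y ++ [ m ])
      O-total : ∀ g y → Vis g y → turn (Γ g) y ≡ O → kids (Γ g) y ≢ fin [] → Σ Move λ m → Vis g (y ++ [ m ])
      no-P-leaf : ∀ g y → Vis g y → kids (Γ g) y ≡ fin [] → win (Γ g) y ≢ pl P
      no-EM : ∀ g y g' y' a → Vis g y → Vis g' y' → kids (Γ g) y ≡ fin [] → kids (Γ g') y' ≡ fin [] →
              win (Γ g) y ≡ par a → win (Γ g') y' ≡ par (dual a) → I a ≡ true → ⊥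
      no-P-play : ∀ g q → (∀ k → Vis g (prefix q k)) → ¬ Pwin (Γ g) q

  tie-break : ∀ x y → x ≢ y → (if x <ᵇ y then P else O) ≡ (if y <ᵇ x then P else O) ᵒᵖ
  tie-break zero zero ne = ⊥-elim (ne refl)
  tie-break zero (suc y) ne = refl
  tie-break (suc x) zero ne = refl
  tie-break (suc x) (suc y) ne = tie-break x y (λ e → ne (cong suc e))

  module _ (em : ExcludedMiddle (Level.suc 0ℓ)) (fv : FVEmpty n Γ I) (br : Branch) where
    open Branch br

    VisitedLeaf : Par → Set
    VisitedLeaf a = Σ (Fin n) λ g → Σ (List Move) λ y →
                      Vis g y × (kids (Γ g) y ≡ fin []) × (win (Γ g) y ≡ par a)

    -- Visited parameter leaves become O-leaves; no-EM says this is consistent with duality.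
    branch-assignment : Par → Player
    branch-assignment a = choose (decide em (VisitedLeaf a)) (decide em (VisitedLeaf (dual a)))
      where
      choose : Dec (VisitedLeaf a) → Dec (VisitedLeaf (dual a)) → Player
      choose (yes _) _ = O
      choose (no _) (yes _) = P
      choose (no _) (no _) = if enc a <ᵇ enc (dual a) then P else O

    branch-assignment-is-assignment : IsAssignment I branch-assignment
    branch-assignment-is-assignment a Ia
      with decide em (VisitedLeaf a) | decide em (VisitedLeaf (dual a)) | decide em (VisitedLeaf (dual (dual a)))
    ... | yes (g , y , v , k , w) | yes (g' , y' , v' , k' , w') | _ = ⊥-elim (no-EM g y g' y' a v v' k k' w w' Ia)
    ... | yes _ | no _ | yes _ = refl
    ... | yes va | no _ | no ¬vdda = ⊥-elim (¬vdda (subst VisitedLeaf (sym (dual-invol a)) va))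
    ... | no _ | yes _ | _ = refl
    ... | no ¬va | no _ | yes vdda = ⊥-elim (¬va (subst VisitedLeaf (dual-invol a) vdda))
    ... | no _ | no _ | no _ rewrite dual-invol a =
          tie-break (enc (dual a)) (enc a) (λ e → dual-nofix a (enc-inj e))

    visited-leaf-O : ∀ a → VisitedLeaf a → branch-assignment a ≡ O
    visited-leaf-O a va with decide em (VisitedLeaf a)
    ... | yes _ = refl
    ... | no ¬va = ⊥-elim (¬va va)

    Vis-prefix : ∀ g x y → Vis g (x ++ y) → Vis g x
    Vis-prefix g x [] v = subst (Vis g) (++-identityʳ x) v
    Vis-prefix g x (m ∷ y) v = parent g x m (Vis-prefix g (x ++ [ m ]) y (subst (Vis g) (sym (++-assoc x [ m ] y)) v))

    Vis-winning : ∀ g → IsGWinning (gameArena (assignG I branch-assignment (Γ g))) O (Vis g)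
    Vis-winning g = ((((strategy , P-moves) , O-moves) , leaves) , no-P-play g)
      where
      η : Par → Player
      η = branch-assignment
      G : Game
      G = Γ g
      kid : ∀ x m → Pos (assignG I η G) (x ++ [ m ]) → m ∈E kids G x
      kid x m p = Pos-∷ʳ⁻ G x m (Pos-assignG⁻ G I η _ p)
      strategy : IsStrategy (gameArena (assignG I η G)) (Vis g)
      strategy = (λ x v → Pos-assignG⁺ G I η x (valid g x v)) , root g , Vis-prefix g
      P-moves : ∀ x → Vis g x → NonLeaf (gameArena (assignG I η G)) x → turn G x ≡ P →
                ∀ m → Pos (assignG I η G) (x ++ [ m ]) → Vis g (x ++ [ m ])
      P-moves x v _ t m p = P-closed g x m v t (kid x m p)
      O-moves : ∀ x → Vis g x → NonLeaf (gameArena (assignG I η G)) x → turn G x ≡ O →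
                Σ Move λ m → Vis g (x ++ [ m ])
      O-moves x v (m , p) t = O-total g x v t λ e → ∉E-fin[] (subst (m ∈E_) e (kid x m p))
      leaves : ∀ x → Vis g x → Leaf (gameArena (assignG I η G)) x → applyA I η (win G x) ≡ pl O
      leaves x v (_ , nl) with leaf⇒kids≡[] G x (valid g x v) (λ m q → nl m (Pos-assignG⁺ G I η _ q))
      ... | kl with win G x in ew
      ... | pl P = ⊥-elim (no-P-leaf g x v kl ew)
      ... | pl O = refl
      ... | par a rewrite fv g a (x , (valid g x v , kl) , inj₁ ew) =
            cong pl (visited-leaf-O a (g , x , v , kl , ew))

    branch⇒OWinsUnderAssignment : OWinsUnderAssignment
    branch⇒OWinsUnderAssignment = branch-assignment , branch-assignment-is-assignment , λ g → Vis g , Vis-winning g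

  child-recorded : ∀ S → Invariant S → ∀ k k' g y m →
                   L S !! k ≡ just (g , y ++ [ m ]) → L S !! k' ≡ just (g , y) → ((k' , m , k) ∈ J S) × (k' < k)
  child-recorded S iv k k' g y m e e' with origin iv k g (y ++ [ m ]) e
  ... | inj₁ (y≡[] , _) = ⊥-elim (∷ʳ≢[] y y≡[])
  ... | inj₂ (a , m' , l , mem , La , eq)
    with refl , e₂ ← ,-injective eq with refl , refl ← ∷ʳ-injective y (proj₂ l) e₂ with refl ← distinct iv a k' _ La e' =
    mem , proj₂ (proj₂ (proj₂ (recorded iv a m k mem)))

  parent-at : ∀ S → Invariant S → ∀ k g y m → L S !! k ≡ just (g , y ++ [ m ]) →
              Σ ℕ λ a → L S !! a ≡ just (g , y)
  parent-at S iv k g y m e with origin iv k g (y ++ [ m ]) e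
  ... | inj₁ (y≡[] , _) = ⊥-elim (∷ʳ≢[] y y≡[])
  ... | inj₂ (a , m' , l , _ , La , eq)
    with refl , e₂ ← ,-injective eq with refl , refl ← ∷ʳ-injective y (proj₂ l) e₂ = a , La

  child-at : ∀ S → Invariant S → ∀ k g y m q → L S !! k ≡ just (g , y) → (k , m , q) ∈ J S →
             L S !! q ≡ just (g , y ++ [ m ])
  child-at S iv k g y m q e mem with l , La , Lq , _ ← recorded iv k m q mem with refl ← trans (sym e) La = Lq

  Exhausted : ExhState → Set
  Exhausted S = ∀ j → j < length (L S) → Skips (L S) (J S) (length (L S)) j

  exhausted-branch : ∀ S → Invariant S → Exhausted S → Branch
  exhausted-branch S iv sk = record
    { Vis = Vis
    ; root = λ g → toℕ g , roots iv g
    ; valid = λ g y (k , e) → positions iv k (g , y) e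
    ; parent = λ g y m (k , e) → parent-at S iv k g y m e
    ; P-closed = P-closed
    ; O-total = O-total
    ; no-P-leaf = λ g y (k , e) → Skips⇒¬winP (skip k e) e
    ; no-EM = no-EM
    ; no-P-play = no-P-play
    }
    where
    Vis : Fin n → List Move → Set
    Vis g y = Σ ℕ λ k → L S !! k ≡ just (g , y)
    skip : ∀ k {l} → L S !! k ≡ just l → Skips (L S) (J S) (length (L S)) k
    skip k e = sk k (!!⇒<length (L S) k e)
    P-closed : ∀ g y m → Vis g y → turn (Γ g) y ≡ P → m ∈E kids (Γ g) y → Vis g (y ++ [ m ])
    P-closed g y m (k , e) t mem
      with q , mq ← inJ-sound k m (J S) (firstFree-nothing-∈E k (J S) (kids (Γ g) y) m
             (Skips⇒firstFree≡nothing (skip k e) e (∈E⇒¬isEmptyE _ m mem) t) mem (kids-inf (Γ g) y)) =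
      q , child-at S iv k g y m q e mq
    O-total : ∀ g y → Vis g y → turn (Γ g) y ≡ O → kids (Γ g) y ≢ fin [] → Σ Move λ m → Vis g (y ++ [ m ])
    O-total g y (k , e) t ne with m , q , mq ← hasI-sound k (J S) (Skips⇒hasI (skip k e) e (≢[]⇒¬isEmptyE _ ne) t) =
      m , q , child-at S iv k g y m q e mq
    no-EM : ∀ g y g' y' a → Vis g y → Vis g' y' → kids (Γ g) y ≡ fin [] → kids (Γ g') y' ≡ fin [] →
            win (Γ g) y ≡ par a → win (Γ g') y' ≡ par (dual a) → I a ≡ true → ⊥
    no-EM g y g' y' a (k , e) (k' , e') kl kl' w w' Ia =
      findEND-nothing (L S) (par (dual a)) (length (L S)) 0 k'
        (Skips⇒findEND≡nothing (skip k e) e kl w Ia)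
        (isENDb-complete (L S) k' _ ((g' , y') , e' , kl' , w')) z≤n
        (subst (k' <_) (sym (+-identityʳ _)) (!!⇒<length (L S) k' e'))
    -- The visited prefixes of an infinite play would need unboundedly many indices of the finite list L S.
    no-P-play : ∀ g q → (∀ s → Vis g (prefix q s)) → ¬ Pwin (Γ g) q
    no-P-play g q V _ = ≤⇒≯ (index-grows (length (L S))) (!!⇒<length (L S) _ (proj₂ (V (length (L S)))))
      where
      index-grows : ∀ s → s ≤ proj₁ (V s)
      index-grows zero = z≤n
      index-grows (suc s) = ≤-trans (s≤s (index-grows s))
        (proj₂ (child-recorded S iv (proj₁ (V (suc s))) (proj₁ (V s)) g (prefix q s) (q s)
                               (proj₂ (V (suc s))) (proj₂ (V s))))

  finite-failure-exhausted : ∀ S x → Invariant S → InExhAt S x → ValidFrom (atP (L S)) x →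
                             (∀ m → ¬ ValidFrom (atP (L S)) (x ++ [ m ])) → winS (run (atP (L S)) x) ≢ pl P →
                             Σ ExhState λ S' → Invariant S' × Exhausted S'
  finite-failure-exhausted S [] iv h v nl nw = ⊥-elim (nl (DROP (length (L S))) (refl , tt))
  finite-failure-exhausted S (a ∷ []) iv h v nl nw with exhAct (L S) (i S) (c S) (J S) | exhAction S (wellShaped iv)
  finite-failure-exhausted S (a ∷ []) iv refl v nl nw | leafMove _ | actDROP sk = S , iv , sk
  finite-failure-exhausted S (a ∷ []) iv refl v nl nw | leafMove _ | actEM j j' _ = ⊥-elim (nw refl)
  finite-failure-exhausted S (a ∷ []) iv refl v nl nw | leafMove _ | actSTOP j l e₁ _ w
    rewrite step-STOP (L S) j e₁ = ⊥-elim (nw w)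
  finite-failure-exhausted S (a ∷ []) iv refl v nl nw | justP j l m c' | actP _ _ _ _ e₁ e₂ _ e₅ _ _ =
    ⊥-elim (nl m (proj₁ v , subst (λ s → Legal s m) (sym (step-JUST (L S) j (length (L S)) e₁))
                                  (firstFree-∈E j (J S) _ e₅) , tt))
  finite-failure-exhausted S (a ∷ []) iv refl v nl nw | justO j l c' | actO _ _ _ e₁ e₂ _ _ _ _
    with m , mem ← ¬isEmptyE⇒∈E _ e₂ =
    ⊥-elim (nl m (proj₁ v , subst (λ s → Legal s m) (sym (step-JUST (L S) j (length (L S)) e₁)) mem , tt))
  finite-failure-exhausted S (a ∷ m ∷ ys) iv h v nl nw with exhAct (L S) (i S) (c S) (J S) | exhAction S (wellShaped iv)
  ... | leafMove _ | _ = ⊥-elim h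
  ... | justP j l m' c' | actP _ _ _ _ e₁ e₂ _ e₅ lt le with h
  ...   | refl , refl , rest rewrite step-JUST (L S) j (length (L S)) e₁ =
          finite-failure-exhausted (descend S j l m c') ys
            (descend-Invariant S j l m c' iv e₁ (firstFree-∈E j (J S) (kidsL l) e₅)
                               (firstFree-fresh j (J S) (kidsL l) e₅) lt le)
            rest (proj₂ (proj₂ v)) (λ m₂ v₂ → nl m₂ (proj₁ v , proj₁ (proj₂ v) , v₂)) nw
  finite-failure-exhausted S (a ∷ m ∷ ys) iv h v nl nw | justO j l c' | actO _ _ _ e₁ e₂ _ e₅ lt le with h
  ...   | refl , mem , rest rewrite step-JUST (L S) j (length (L S)) e₁ =
          finite-failure-exhausted (descend S j l m c') ys
            (descend-Invariant S j l m c' iv e₁ mem (¬hasI⇒¬inJ j m (J S) e₅) lt le)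
            rest (proj₂ (proj₂ v)) (λ m₂ v₂ → nl m₂ (proj₁ v , proj₁ (proj₂ v) , v₂)) nw

  data Descends (j : ℕ) (l : Loc) (m : Move) (c' : ℕ) : Act → Set where
    viaP : Descends j l m c' (justP j l m c')
    viaO : Descends j l m c' (justO j l c')

  record Descent (S : ExhState) (a m : Move) : Set where
    field
      from : ℕ
      loc : Loc
      bound : ℕ
      move≡ : a ≡ JUST from (length (L S))
      loc≡ : L S !! from ≡ just loc
      child∈ : m ∈E kidsL loc
      fresh : inJ from m (J S) ≡ false
      from<bound : suc from ≤ bound
      bound≤ : bound ≤ length (L S)
      next≡ : next S m ≡ descend S from loc m bound
      descends : Descends from loc m bound (exhAct (L S) (i S) (c S) (J S))

  descent : ∀ S a m ys → WellShaped S → InExhAt S (a ∷ m ∷ ys) → Descent S a m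
  descent S a m ys sh h with exhAct (L S) (i S) (c S) (J S) in eq | exhAction S sh
  ... | leafMove _ | _ = ⊥-elim h
  ... | justP j l _ c' | actP _ _ _ _ e₁ _ _ e₅ lt le with pa , refl , _ ← h =
    record { move≡ = pa ; loc≡ = e₁ ; child∈ = firstFree-∈E j (J S) (kidsL l) e₅
           ; fresh = firstFree-fresh j (J S) (kidsL l) e₅ ; from<bound = lt ; bound≤ = le
           ; next≡ = cong (λ A → advance S A m) eq ; descends = subst (Descends j l m c') (sym eq) viaP }
  ... | justO j l c' | actO _ _ _ e₁ _ _ e₅ lt le with pa , mem , _ ← h =
    record { move≡ = pa ; loc≡ = e₁ ; child∈ = mem
           ; fresh = ¬hasI⇒¬inJ j m (J S) e₅ ; from<bound = lt ; bound≤ = le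
           ; next≡ = cong (λ A → advance S A m) eq ; descends = subst (Descends j l m c') (sym eq) viaO }

  next-Invariant : ∀ S a m ys → Invariant S → InExhAt S (a ∷ m ∷ ys) → Invariant (next S m)
  next-Invariant S a m ys iv h = subst Invariant (sym next≡)
    (descend-Invariant S from loc m bound iv loc≡ child∈ fresh from<bound bound≤)
    where open Descent (descent S a m ys (wellShaped iv) h)

  fires-descends : ∀ {L J C k A j l m c'} → Fires L J C k A → Descends j l m c' A →
                   (k ≡ j) × (C ≡ c') × (L !! k ≡ just l) × (turnL l ≡ P → firstFree k J (kidsL l) ≡ just m)
  fires-descends (fireP _ _ e₁ _ _ e₅) viaP = refl , refl , e₁ , λ _ → e₅
  fires-descends (fireO _ e₁ _ e₄ _) viaO = refl , refl , e₁ , λ tP → ⊥-elim (P≢O (trans (sym tP) e₄))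

  data ExhStep (L : List Loc) (i c : ℕ) (J : Triples) (A : Act) (i' c' : ℕ) : Set where
    inRound : ∀ j → i ≤ j → j < c → clauseAt L J c j ≡ just A →
              (∀ j' → i ≤ j' → j' < j → Skips L J c j') → i' ≡ suc j → c' ≡ c → ExhStep L i c J A i' c'
    newRound : (∀ j → i ≤ j → j < c → Skips L J c j) →
               ∀ j → j < length L → clauseAt L J (length L) j ≡ just A →
               (∀ j' → j' < j → Skips L J (length L) j') → i' ≡ suc j → c' ≡ length L → ExhStep L i c J A i' c'

  exhStep : ∀ {L i c J A j l m c'} → ExhView L i c J A → Descends j l m c' A → ExhStep L i c J A (suc j) c'
  exhStep {L} {c = c} {J} (inRound k a b cl sk) d with refl , refl , _ ← fires-descends (clauseAt-fires L J c k cl) d =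
    inRound k a b cl sk refl refl
  exhStep {L} {J = J} (newRound sk₁ _ k b cl sk) d
    with refl , refl , _ ← fires-descends (clauseAt-fires L J (length L) k cl) d =
    newRound sk₁ k b cl sk refl refl

  -- An infinite play of EXH, read as a sequence of descents: at time t exh plays p(2t) = JUST(…)
  -- and O (or exh itself) answers p(2t+1).
  module InfinitePlay (p : ℕ → Move) (inEXH : ∀ k → InExhAt exh₀ (prefix p k)) where

    state : ℕ → ExhState
    state zero = exh₀
    state (suc t) = next (state t) (p (suc (2 * t)))

    prefix-2suc : ∀ t ys → prefix p (2 * suc t) ++ ys ≡ prefix p (2 * t) ++ (p (2 * t) ∷ p (suc (2 * t)) ∷ ys)
    prefix-2suc t ys = begin
      prefix p (2 * suc t) ++ ys                                       ≡⟨ cong (λ k → prefix p k ++ ys) (*-suc 2 t) ⟩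
      ((prefix p (2 * t) ++ [ p (2 * t) ]) ++ [ p (suc (2 * t)) ]) ++ ys ≡⟨ ++-assoc (prefix p (2 * t) ++ _) _ ys ⟩
      (prefix p (2 * t) ++ [ p (2 * t) ]) ++ (p (suc (2 * t)) ∷ ys)    ≡⟨ ++-assoc (prefix p (2 * t)) _ _ ⟩
      prefix p (2 * t) ++ (p (2 * t) ∷ p (suc (2 * t)) ∷ ys)          ∎
      where open ≡-Reasoning

    InExhAt-state : ∀ t ys → InExhAt exh₀ (prefix p (2 * t) ++ ys) → InExhAt (state t) ys
    InExhAt-state zero ys h = h
    InExhAt-state (suc t) ys h = InExhAt-next (state t) _ _ ys (InExhAt-state t _ (subst (InExhAt exh₀) (prefix-2suc t ys) h))

    descent-played : ∀ t → InExhAt (state t) (p (2 * t) ∷ p (suc (2 * t)) ∷ [])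
    descent-played t = InExhAt-state t _ (subst (InExhAt exh₀) (prefix-2suc t [])
      (subst (InExhAt exh₀) (sym (++-identityʳ (prefix p (2 * suc t)))) (inEXH (2 * suc t))))

    inv : ∀ t → Invariant (state t)
    inv zero = invariant₀
    inv (suc t) = next-Invariant (state t) _ _ [] (inv t) (descent-played t)

    desc : ∀ t → Descent (state t) (p (2 * t)) (p (suc (2 * t)))
    desc t = descent (state t) _ _ [] (wellShaped (inv t)) (descent-played t)

    Lt : ℕ → List Loc
    Lt t = L (state t)
    Jt : ℕ → Triples
    Jt t = J (state t)
    ct : ℕ → ℕ
    ct t = c (state t)
    it : ℕ → ℕ
    it t = i (state t)
    actT : ℕ → Act
    actT t = exhAct (Lt t) (it t) (ct t) (Jt t)
    mv : ℕ → Move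
    mv t = p (suc (2 * t))

    open Descent

    Lt-suc : ∀ t → Lt (suc t) ≡ extendL (Lt t) (loc (desc t)) (mv t)
    Lt-suc t = cong L (next≡ (desc t))
    Jt-suc : ∀ t → Jt (suc t) ≡ Jt t ++ [ (from (desc t) , mv t , length (Lt t)) ]
    Jt-suc t = cong J (next≡ (desc t))

    Lt-mono : ∀ {t t'} → t ≤ t' → ∀ k {x} → Lt t !! k ≡ just x → Lt t' !! k ≡ just x
    Lt-mono le k {x} = step-preserved (λ t → Lt t !! k ≡ just x)
      (λ t e → subst (λ L' → L' !! k ≡ just x) (sym (Lt-suc t)) (!!-++ˡ (Lt t) _ k e)) le

    Jt-mono : ∀ {t t'} → t ≤ t' → ∀ {x} → x ∈ Jt t → x ∈ Jt t'
    Jt-mono le {x} = step-preserved (λ t → x ∈ Jt t) (λ t mem → subst (x ∈_) (sym (Jt-suc t)) (∈-++⁺ˡ mem)) le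

    inJ-mono : ∀ {T T'} → T ≤ T' → ∀ k m → inJ k m (Jt T) ≡ true → inJ k m (Jt T') ≡ true
    inJ-mono le k m h with q , mem ← inJ-sound k m _ h = inJ-complete k m _ q (Jt-mono le mem)

    length-Jt : ∀ t → length (Jt t) ≡ t
    length-Jt zero = refl
    length-Jt (suc t) rewrite Jt-suc t = trans (length-∷ʳ (Jt t) _) (cong suc (length-Jt t))

    length-Lt : ∀ t → length (Lt (suc t)) ≡ suc (length (Lt t))
    length-Lt t rewrite Lt-suc t = length-∷ʳ (Lt t) _

    explored : ∀ t → (from (desc t) , mv t , length (Lt t)) ∈ Jt (suc t)
    explored t rewrite Jt-suc t = ∈-++⁺ʳ (Jt t) (here refl)

    Jt-played : ∀ t a m q → (a , m , q) ∈ Jt t → Σ ℕ λ t' → (p (2 * t') ≡ JUST a q) × (p (suc (2 * t')) ≡ m)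
    Jt-played (suc t) a m q mem rewrite Jt-suc t with ∈-++⁻ (Jt t) mem
    ... | inj₁ r = Jt-played t a m q r
    ... | inj₂ (here refl) = t , move≡ (desc t) , refl

    StepView : ℕ → Set
    StepView t = ExhStep (Lt t) (it t) (ct t) (Jt t) (actT t) (it (suc t)) (ct (suc t))

    stepView : ∀ t → StepView t
    stepView t = subst₂ (ExhStep (Lt t) (it t) (ct t) (Jt t) (actT t)) (sym (cong i (next≡ D))) (sym (cong c (next≡ D)))
      (exhStep (exhView (Lt t) (it t) (ct t) (Jt t) (proj₁ (wellShaped (inv t)))) (descends D))
      where
      D : Descent (state t) (p (2 * t)) (p (suc (2 * t)))
      D = desc t

    ct≤length : ∀ t → ct t ≤ length (Lt t)
    ct≤length t = proj₁ (proj₂ (wellShaped (inv t)))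

    ct-suc : ∀ t → ct t ≤ ct (suc t)
    ct-suc t with stepView t
    ... | inRound _ _ _ _ _ _ ec = ≤-reflexive (sym ec)
    ... | newRound _ _ _ _ _ _ ec = subst (ct t ≤_) (sym ec) (ct≤length t)

    ct-mono : ∀ {t t'} → t ≤ t' → ct t ≤ ct t'
    ct-mono {t} le = step-preserved (λ t' → ct t ≤ ct t') (λ t' h → ≤-trans h (ct-suc t')) le ≤-refl

    -- Local position k is considered at a time t' ≥ t within a bound C ≥ c_t: its clause is either
    -- skipped or is the one exh acts on.
    Considered : ℕ → ℕ → Set
    Considered t k = Σ ℕ λ t' → (t ≤ t') × Σ ℕ λ C → (ct t ≤ C) × (k < C) × (C ≤ ct (suc t')) ×
                     (Skips (Lt t') (Jt t') C k ⊎ clauseAt (Lt t') (Jt t') C k ≡ just (actT t'))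

    considered-suc : ∀ t k → Considered (suc t) k → Considered t k
    considered-suc t k (t' , le , C , a , b , c₁ , r) =
      t' , ≤-trans (n≤1+n t) le , C , ≤-trans (ct-suc t) a , b , c₁ , r

    fuel-step : ∀ d i j → i ≤ j → suc d + i ≤ d + suc j
    fuel-step d i j le = subst (suc (d + i) ≤_) (sym (+-suc d j)) (s≤s (+-monoʳ-≤ d le))

    -- The fuel d bounds the number of descents needed before the round reaches k.
    considered-in-round : ∀ d t k → it t ≤ k → k < ct t → k < d + it t → Considered t k
    considered-in-round zero t k a b e = ⊥-elim (≤⇒≯ a e)
    considered-in-round (suc d) t k a b e with stepView t
    ... | newRound sk₁ j _ _ _ ei ec =
          t , ≤-refl , ct t , ≤-refl , b , subst (ct t ≤_) (sym ec) (ct≤length t) , inj₁ (sk₁ k a b)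
    ... | inRound j i≤j j<c cl sk ei ec with <-cmp k j
    ...   | tri< k<j _ _ = t , ≤-refl , ct t , ≤-refl , b , ≤-reflexive (sym ec) , inj₁ (sk k a k<j)
    ...   | tri≈ _ refl _ = t , ≤-refl , ct t , ≤-refl , b , ≤-reflexive (sym ec) , inj₂ cl
    ...   | tri> _ _ j<k = considered-suc t k (considered-in-round d (suc t) k (subst (_≤ k) (sym ei) j<k)
              (subst (k <_) (sym ec) b) (subst (λ z → k < d + z) (sym ei) (<-≤-trans e (fuel-step d (it t) j i≤j))))

    considered : ∀ d t k → k < length (Lt t) → ct t < d + it t → Considered t k
    considered d t k lt f with it t ≤? k | k <? ct t
    ... | yes a | yes b = considered-in-round (suc k) t k a b (s≤s (m≤m+n k (it t)))
    ... | _ | _ with stepView t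
    considered zero t k lt f | _ | _ | inRound j i≤j j<c cl sk ei ec = ⊥-elim (≤⇒≯ (proj₁ (wellShaped (inv t))) f)
    considered (suc d) t k lt f | _ | _ | inRound j i≤j j<c cl sk ei ec =
      considered-suc t k (considered d (suc t) k (subst (k <_) (sym (length-Lt t)) (<-trans lt (n<1+n _)))
        (subst₂ (λ a b → a < d + b) (sym ec) (sym ei) (<-≤-trans f (fuel-step d (it t) j i≤j))))
    considered d t k lt f | _ | _ | newRound sk₁ j j<L cl sk₂ ei ec with <-cmp k j
    ... | tri< k<j _ _ = t , ≤-refl , length (Lt t) , ct≤length t , lt , ≤-reflexive (sym ec) , inj₁ (sk₂ k k<j)
    ... | tri≈ _ refl _ = t , ≤-refl , length (Lt t) , ct≤length t , lt , ≤-reflexive (sym ec) , inj₂ cl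
    ... | tri> _ _ j<k = considered-suc t k (considered-in-round (suc k) (suc t) k (subst (_≤ k) (sym ei) j<k)
            (subst (k <_) (sym ec) lt) (s≤s (m≤m+n k _)))

    eventually-considered : ∀ t k → k < length (Lt t) → Considered t k
    eventually-considered t k lt = considered (suc (ct t)) t k lt (s≤s (m≤m+n (ct t) (it t)))

    Vis : Fin n → List Move → Set
    Vis g y = Σ ℕ λ t → Σ ℕ λ k → Lt t !! k ≡ just (g , y)

    child-visited : ∀ t g y k m q → Lt t !! k ≡ just (g , y) → (k , m , q) ∈ Jt t → Vis g (y ++ [ m ])
    child-visited t g y k m q e mem = t , q , child-at (state t) (inv t) k g y m q e mem

    considered-later : ∀ t {k l} → Lt t !! k ≡ just l → Σ ℕ λ t' → (t ≤ t') × (Lt t' !! k ≡ just l) ×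
                       Σ ℕ λ C → Skips (Lt t') (Jt t') C k ⊎ clauseAt (Lt t') (Jt t') C k ≡ just (actT t')
    considered-later t {k} e with t' , le , C , _ , _ , _ , r ← eventually-considered t k (!!⇒<length (Lt t) k e) =
      t' , le , Lt-mono le k e , C , r

    record Fired (t' k : ℕ) (l : Loc) : Set where
      field
        child∈ : mv t' ∈E kidsL l
        recorded : (k , mv t' , length (Lt t')) ∈ Jt (suc t')
        at-P : turnL l ≡ P → firstFree k (Jt t') (kidsL l) ≡ just (mv t')

    fired : ∀ t' {k C l} → clauseAt (Lt t') (Jt t') C k ≡ just (actT t') → Lt t' !! k ≡ just l → Fired t' k l
    fired t' {k} {C} cl e with refl , _ , e₁ , f ← fires-descends (clauseAt-fires (Lt t') (Jt t') C k cl) (descends (desc t'))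
                          with refl ← trans (sym e) e₁ =
      record { child∈ = child∈ (desc t') ; recorded = explored t' ; at-P = f }

    no-P-leaf : ∀ g y → Vis g y → kids (Γ g) y ≡ fin [] → win (Γ g) y ≢ pl P
    no-P-leaf g y (t , k , e) kl with considered-later t e
    ... | t' , _ , e' , C , inj₁ sk = Skips⇒¬winP sk e' kl
    ... | t' , _ , e' , C , inj₂ cl = ⊥-elim (∉E-fin[] (subst (mv t' ∈E_) kl (Fired.child∈ (fired t' cl e'))))

    no-EM : ∀ g y g' y' a → Vis g y → Vis g' y' → kids (Γ g) y ≡ fin [] → kids (Γ g') y' ≡ fin [] →
            win (Γ g) y ≡ par a → win (Γ g') y' ≡ par (dual a) → I a ≡ true → ⊥
    no-EM g y g' y' a (t , k , e) (t₂ , k' , e') kl kl' w w' Ia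
      with t₃ , le₃ , C₃ , _ , k'<C₃ , C₃≤ , _ ← eventually-considered t₂ k' (!!⇒<length (Lt t₂) k' e')
      with t' , le , C , ct≤C , _ , _ , r ← eventually-considered (t + suc t₃) k
             (!!⇒<length (Lt (t + suc t₃)) k (Lt-mono (m≤m+n t (suc t₃)) k e)) = outcome r
      where
      eT : Lt t' !! k ≡ just (g , y)
      eT = Lt-mono (≤-trans (m≤m+n t (suc t₃)) le) k e
      e'T : Lt t' !! k' ≡ just (g' , y')
      e'T = Lt-mono (≤-trans (≤-trans le₃ (≤-trans (n≤1+n t₃) (m≤n+m (suc t₃) t))) le) k' e'
      k'<C : k' < C
      k'<C = <-≤-trans k'<C₃ (≤-trans C₃≤ (≤-trans (ct-mono (m≤n+m (suc t₃) t)) ct≤C))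
      outcome : Skips (Lt t') (Jt t') C k ⊎ clauseAt (Lt t') (Jt t') C k ≡ just (actT t') → ⊥
      outcome (inj₁ sk) = findEND-nothing (Lt t') (par (dual a)) C 0 k'
        (Skips⇒findEND≡nothing sk eT kl w Ia)
        (isENDb-complete (Lt t') k' _ ((g' , y') , e'T , kl' , w')) z≤n
        (subst (k' <_) (sym (+-identityʳ _)) k'<C)
      outcome (inj₂ cl) = ∉E-fin[] (subst (mv t' ∈E_) kl (Fired.child∈ (fired t' cl eT)))

    O-total : ∀ g y → Vis g y → turn (Γ g) y ≡ O → kids (Γ g) y ≢ fin [] → Σ Move λ m → Vis g (y ++ [ m ])
    O-total g y (t , k , e) tO ne with considered-later t e
    ... | t' , _ , e' , C , inj₁ sk
      with m , q , mem ← hasI-sound k (Jt t') (Skips⇒hasI sk e' (≢[]⇒¬isEmptyE _ ne) tO) =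
      m , child-visited t' g y k m q e' mem
    ... | t' , _ , e' , C , inj₂ cl =
      mv t' , child-visited (suc t') g y k (mv t') (length (Lt t')) (Lt-mono (n≤1+n t') k e') (Fired.recorded (fired t' cl e'))

    Recorded : ℕ → Enum → ℕ → ℕ → Set
    Recorded k e s T = ∀ u m → u < s → entry e u ≡ just m → inJ k m (Jt T) ≡ true

    Recorded-suc : ∀ {k e s T T'} → Recorded k e s T → T ≤ T' →
                   (∀ m → entry e s ≡ just m → inJ k m (Jt T') ≡ true) → Recorded k e (suc s) T'
    Recorded-suc {k} {s = s} H le h u m (s≤s u≤s) ev with m≤n⇒m<n∨m≡n u≤s
    ... | inj₁ u<s = inJ-mono le k m (H u m u<s ev)
    ... | inj₂ refl = h m ev

    -- When exh next considers the node, it either skips it (all entries are recorded) or descends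
    -- along its first unrecorded entry, which is entry s by minimality.
    entry-recorded : ∀ t {k g y} → Lt t !! k ≡ just (g , y) → turn (Γ g) y ≡ P → ∀ s T ms → t ≤ T →
                     Recorded k (kids (Γ g) y) s T → entry (kids (Γ g) y) s ≡ just ms →
                     Σ ℕ λ T' → (T ≤ T') × (inJ k ms (Jt T') ≡ true)
    entry-recorded t {k} {g} {y} e tP s T ms tT H es with inJ k ms (Jt T) in ei
    ... | true = T , ≤-refl , ei
    ... | false with considered-later (T + s) (Lt-mono (≤-trans tT (m≤m+n T s)) k e)
    ...   | t' , le , e' , C , inj₁ sk =
            t' , ≤-trans (m≤m+n T s) le ,
            firstFree-nothing-entry k (Jt t') (kids (Γ g) y) s
              (Skips⇒firstFree≡nothing sk e' (∈E⇒¬isEmptyE _ ms (entry⇒∈E _ s es)) tP) es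
              (subst (s ≤_) (sym (length-Jt t')) (≤-trans (m≤n+m s T) le))
    ...   | t' , le , e' , C , inj₂ cl with inJ k ms (Jt t') in ei'
    ...     | true = t' , ≤-trans (m≤m+n T s) le , ei'
    ...     | false with u , eu , fresh , minimal ← firstFree-just k (Jt t') (kids (Γ g) y) (Fired.at-P (fired t' cl e') tP)
                    with <-cmp u s
    ...       | tri< u<s _ _ with () ← trans (sym fresh) (inJ-mono (≤-trans (m≤m+n T s) le) k (mv t') (H u (mv t') u<s eu))
    ...       | tri> _ _ s<u with () ← trans (sym ei') (minimal s ms s<u es)
    ...       | tri≈ _ refl _ with refl ← just-injective (trans (sym es) eu) =
            suc t' , ≤-trans (m≤m+n T s) (≤-trans le (n≤1+n t')) ,
            inJ-complete k ms (Jt (suc t')) (length (Lt t')) (Fired.recorded (fired t' cl e'))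

    entries-recorded : ∀ t {k g y} → Lt t !! k ≡ just (g , y) → turn (Γ g) y ≡ P → ∀ s →
                       Σ ℕ λ T → (t ≤ T) × Recorded k (kids (Γ g) y) s T
    entries-recorded t e tP zero = t , ≤-refl , λ _ _ ()
    entries-recorded t {k} {g} {y} e tP (suc s) with T , tT , H ← entries-recorded t e tP s
      with entry (kids (Γ g) y) s in es
    ... | nothing = T , tT , Recorded-suc {k} {kids (Γ g) y} {s} {T} H ≤-refl
                               (λ m ev → ⊥-elim (nothing≢just (trans (sym es) ev)))
    ... | just ms with T' , TT' , h ← entry-recorded t e tP s T ms tT H es =
      T' , ≤-trans tT TT' , Recorded-suc {k} {kids (Γ g) y} {s} {T} H TT'
                              (λ m ev → subst (λ z → inJ k z (Jt T') ≡ true) (just-injective (trans (sym es) ev)) h)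

    P-closed : ∀ g y m → Vis g y → turn (Γ g) y ≡ P → m ∈E kids (Γ g) y → Vis g (y ++ [ m ])
    P-closed g y m (t , k , e) tP mem
      with u , eu ← ∈E⇒entry _ mem
      with T , tT , H ← entries-recorded t e tP (suc u)
      with q , mq ← inJ-sound k m (Jt T) (H u m (n<1+n u) eu) = child-visited T g y k m q (Lt-mono tT k e) mq

    -- The indices of the visited positions y₀ ⊑ y₁ ⊑ … of an infinite local play form the chain
    -- witnessing that the play is ≺ p.
    no-P-play : ¬ ForallPwin p → ∀ g q → (∀ s → Vis g (prefix q s)) → ¬ Pwin (Γ g) q
    no-P-play ¬won g q V pw = ¬won (g , q , (js , js₀ , chain) , pw)
      where
      ts : ℕ → ℕ
      ts s = proj₁ (V s)
      js : ℕ → ℕ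
      js s = proj₁ (proj₂ (V s))
      es : ∀ s → Lt (ts s) !! js s ≡ just (g , prefix q s)
      es s = proj₂ (proj₂ (V s))
      js₀ : js 0 ≡ toℕ g
      js₀ with origin (inv (ts 0)) (js 0) g [] (es 0)
      ... | inj₁ (_ , eq) = eq
      ... | inj₂ (_ , _ , l , _ , _ , z) = ⊥-elim (∷ʳ≢[] (proj₂ l) (sym (proj₂ (,-injective z))))
      chain : ∀ s → (js s < js (suc s)) × Derives p (js s) (q s) (js (suc s))
      chain s with mem , lt ← child-recorded (state (ts s + ts (suc s))) (inv (ts s + ts (suc s)))
                                (js (suc s)) (js s) g (prefix q s) (q s)
                                (Lt-mono (m≤n+m (ts (suc s)) (ts s)) _ (es (suc s)))
                                (Lt-mono (m≤m+n (ts s) (ts (suc s))) _ (es s))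
              with t' , pa , pm ← Jt-played (ts s + ts (suc s)) _ _ _ mem = lt , t' , pa , pm

    play-branch : ¬ ForallPwin p → Branch
    play-branch ¬won = record
      { Vis = Vis
      ; root = λ g → 0 , toℕ g , roots invariant₀ g
      ; valid = λ g y (t , k , e) → positions (inv t) k (g , y) e
      ; parent = λ g y m (t , k , e) → let (a , La) = parent-at (state t) (inv t) k g y m e in t , a , La
      ; P-closed = P-closed
      ; O-total = O-total
      ; no-P-leaf = no-P-leaf
      ; no-EM = no-EM
      ; no-P-play = no-P-play ¬won
      }

  ValidFrom-∷ʳ⁻ : ∀ s xs m → ValidFrom s (xs ++ [ m ]) → Legal (run s xs) m
  ValidFrom-∷ʳ⁻ s [] m (lg , _) = lg
  ValidFrom-∷ʳ⁻ s (x ∷ xs) m (_ , v) = ValidFrom-∷ʳ⁻ (step s x) xs m v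

  ValidFrom-prefix : ∀ s xs ys → ValidFrom s (xs ++ ys) → ValidFrom s xs
  ValidFrom-prefix s [] ys v = tt
  ValidFrom-prefix s (x ∷ xs) ys (lg , v) = lg , ValidFrom-prefix (step s x) xs ys v

  ValidFrom-∷ʳ : ∀ s xs m → ValidFrom s xs → Legal (run s xs) m → ValidFrom s (xs ++ [ m ])
  ValidFrom-∷ʳ s [] m _ lg = lg , tt
  ValidFrom-∷ʳ s (x ∷ xs) m (l₀ , v) lg = l₀ , ValidFrom-∷ʳ (step s x) xs m v lg

  run-∷ʳ : ∀ s xs m → run s (xs ++ [ m ]) ≡ step (run s xs) m
  run-∷ʳ s [] m = refl
  run-∷ʳ s (x ∷ xs) m = run-∷ʳ (step s x) xs m

  descent-moves : ∀ L (a m : Move) → Legal (atP L) a → Legal (step (atP L) a) m →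
                  Σ ℕ λ i → Σ Loc λ l → (a ≡ JUST i (length L)) × (L !! i ≡ just l) ×
                  (step (step (atP L) a) m ≡ atP (extendL L l m))
  descent-moves L (STOP i) m _ lg with L !! i
  descent-moves L (STOP i) m _ () | just _
  descent-moves L (STOP i) m _ () | nothing
  descent-moves L (JUST i k) m (refl , l , el , _) lg rewrite step-JUST L i k el = i , l , refl , el , refl

  -- O plays τ_g in every local position of G_g; the invariant is that all local positions reached
  -- are positions of the corresponding τ_g.
  module FromLocalStrategies (fv : FVEmpty n Γ I) (η : Par → Player) (η-assignment : IsAssignment I η)
           (τs : ∀ i → Σ (List Move → Set) λ τ → IsGWinning (gameArena (assignG I η (Γ i))) O τ) where

    τ : Fin n → List Move → Set
    τ g = proj₁ (τs g)

    τ-pos : ∀ g y → τ g y → Pos (Γ g) y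
    τ-pos g y h = Pos-assignG⁻ (Γ g) I η y (proj₁ (proj₁ (proj₁ (proj₁ (proj₁ (proj₂ (τs g)))))) y h)

    τ-root : ∀ g → τ g []
    τ-root g = proj₁ (proj₂ (proj₁ (proj₁ (proj₁ (proj₁ (proj₂ (τs g)))))))

    τ-child : ∀ g y m → τ g y → m ∈E kids (Γ g) y → Pos (assignG I η (Γ g)) (y ++ [ m ])
    τ-child g y m h mem = Pos-assignG⁺ (Γ g) I η _ (Pos-∷ʳ (Γ g) y m (τ-pos g y h) mem)

    τ-P-closed : ∀ g y m → τ g y → turn (Γ g) y ≡ P → m ∈E kids (Γ g) y → τ g (y ++ [ m ])
    τ-P-closed g y m h t mem =
      proj₂ (proj₁ (proj₁ (proj₁ (proj₂ (τs g))))) y h (m , τ-child g y m h mem) t m (τ-child g y m h mem)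

    τ-O-total : ∀ g y m → τ g y → turn (Γ g) y ≡ O → m ∈E kids (Γ g) y → Σ Move λ m' → τ g (y ++ [ m' ])
    τ-O-total g y m h t mem = proj₂ (proj₁ (proj₁ (proj₂ (τs g)))) y h (m , τ-child g y m h mem) t

    τ-leaf : ∀ g y → τ g y → kids (Γ g) y ≡ fin [] → applyA I η (win (Γ g) y) ≡ pl O
    τ-leaf g y h kl = proj₂ (proj₁ (proj₂ (τs g))) y h
      (Pos-assignG⁺ (Γ g) I η y (τ-pos g y h) ,
       λ m pm → ∉E-fin[] (subst (m ∈E_) kl (Pos-∷ʳ⁻ (Γ g) y m (Pos-assignG⁻ (Γ g) I η _ pm))))

    τ-play : ∀ g q → (∀ k → τ g (prefix q k)) → ¬ Pwin (Γ g) q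
    τ-play g q = proj₂ (proj₂ (τs g)) q

    GoodL : List Loc → Set
    GoodL L = ∀ k g y → L !! k ≡ just (g , y) → τ g y

    Good : FState → Set
    Good (atP L) = GoodL L
    Good (atJ L l) = GoodL L × τ (proj₁ l) (proj₂ l)
    Good (ended x) = x ≡ pl O

    GoodPath : FState → List Move → Set
    GoodPath s [] = Good s
    GoodPath s (m ∷ ms) = Good s × GoodPath (step s m) ms

    GoodPath-last : ∀ s xs → GoodPath s xs → Good (run s xs)
    GoodPath-last s [] g = g
    GoodPath-last s (x ∷ xs) (_ , g) = GoodPath-last (step s x) xs g

    GoodPath-prefix : ∀ s xs ys → GoodPath s (xs ++ ys) → GoodPath s xs
    GoodPath-prefix s [] [] g = g
    GoodPath-prefix s [] (y ∷ ys) (g , _) = g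
    GoodPath-prefix s (x ∷ xs) ys (g , r) = g , GoodPath-prefix (step s x) xs ys r

    GoodPath-∷ʳ : ∀ s xs m → GoodPath s xs → Good (step (run s xs) m) → GoodPath s (xs ++ [ m ])
    GoodPath-∷ʳ s [] m g g' = g , g'
    GoodPath-∷ʳ s (x ∷ xs) m (g , r) g' = g , GoodPath-∷ʳ (step s x) xs m r g'

    GoodL-∷ʳ : ∀ L g y → GoodL L → τ g y → GoodL (L ++ [ (g , y) ])
    GoodL-∷ʳ L g y gl t k g' y' e with !!-∷ʳ⁻ L (g , y) k e
    ... | inj₁ e' = gl k g' y' e'
    ... | inj₂ (_ , refl) = t

    GoodL-initLocs : GoodL initLocs
    GoodL-initLocs k g y e with refl , _ ← initLocs⁻ k g y e = τ-root g

    σ : List Move → Set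
    σ x = ValidFrom init x × GoodPath init x

    leaf-assigned-O : ∀ L {i x} → IsEND L i x → GoodL L → ∀ a → x ≡ par a → η a ≡ O
    leaf-assigned-O L ((g , y) , e₁ , kl , w) gl a refl with τ-leaf g y (gl _ g y e₁) kl
    ... | wO rewrite w | fv g a (y , (τ-pos g y (gl _ g y e₁) , kl) , inj₁ w) = pl-injective wO

    STOP-good : ∀ L i x → IsEND L i x → Free x → GoodL L → Good (step (atP L) (STOP i))
    STOP-good L i x (l@(g , y) , el , kl , wl) fr gl rewrite step-STOP L i el with winL l in w | τ-leaf g y (gl i g y el) kl
    ... | pl P | ()
    ... | pl O | _ = refl
    ... | par a | _
      with () ← trans (sym (subst Free (sym wl) fr)) (fv g a (y , (τ-pos g y (gl i g y el) , kl) , inj₁ w))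

    P-move-good : ∀ s m → Good s → turnS s ≡ P → Legal s m → Good (step s m)
    P-move-good (atP L) (DROP _) gs _ _ = refl
    P-move-good (atP L) (EM i j) gs _ (a , e₁ , e₂ , Ia) = ⊥-elim (P≢O (sym (begin
      O          ≡⟨ sym (leaf-assigned-O L e₂ gs (dual a) refl) ⟩
      η (dual a) ≡⟨ η-assignment a Ia ⟩
      η a ᵒᵖ     ≡⟨ cong _ᵒᵖ (leaf-assigned-O L e₁ gs a refl) ⟩
      P          ∎)))
      where open ≡-Reasoning
    P-move-good (atP L) (STOP i) gs _ (x , end , fr) = STOP-good L i x end fr gs
    P-move-good (atP L) (JUST i k) gs _ (_ , l , el , _) rewrite step-JUST L i k el = gs , gs i (proj₁ l) (proj₂ l) el
    P-move-good (atJ L (g , y)) m (gl , t) tP mem = GoodL-∷ʳ L g (y ++ [ m ]) gl (τ-P-closed g y m t tP mem)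

    Good⇒winS : ∀ s → Good s → winS s ≡ pl O
    Good⇒winS (atP _) _ = refl
    Good⇒winS (atJ _ _) _ = refl
    Good⇒winS (ended x) g = g

    σ-O-total : ∀ x → σ x → NonLeaf ForallArena x → turnS (run init x) ≡ O → Σ Move λ m → σ (x ++ [ m ])
    σ-O-total x (v , gp) (m₀ , v₀) t with run init x in er | GoodPath-last init x gp | ValidFrom-∷ʳ⁻ init x m₀ v₀
    ... | atP L | _ | _ = ⊥-elim (P≢O t)
    ... | ended _ | _ | _ = ⊥-elim (P≢O t)
    ... | atJ L (g , y) | (gl , ty) | mem with m , ty' ← τ-O-total g y m₀ ty t mem =
      m , ValidFrom-∷ʳ init x m v (subst (λ s → Legal s m) (sym er) (Pos-∷ʳ⁻ (Γ g) y m (τ-pos g (y ++ [ m ]) ty'))) ,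
          GoodPath-∷ʳ init x m gp (subst (λ s → Good (step s m)) (sym er) (GoodL-∷ʳ L g (y ++ [ m ]) gl ty'))

    -- Along an infinite play of σ, the local positions form a growing list whose entries all lie
    -- in the τ_g; so any infinite local play q ≺ p is a play of some τ_g.
    module _ (p : ℕ → Move) (inσ : ∀ k → σ (prefix p k)) where

      state : ℕ → FState
      state k = run init (prefix p k)

      state-suc : ∀ k → state (suc k) ≡ step (state k) (p k)
      state-suc k = run-∷ʳ init (prefix p k) (p k)

      legal : ∀ k → Legal (state k) (p k)
      legal k = ValidFrom-∷ʳ⁻ init (prefix p k) (p k) (proj₁ (inσ (suc k)))

      record LocalDescent (t : ℕ) (L : List Loc) : Set where
        field
          from : ℕ
          loc : Loc
          move≡ : p (2 * t) ≡ JUST from (length L)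
          loc≡ : L !! from ≡ just loc
          after : state (2 * suc t) ≡ atP (extendL L loc (p (suc (2 * t))))

      descent-at : ∀ t L → state (2 * t) ≡ atP L → LocalDescent t L
      descent-at t L e with after-JUST ← trans (state-suc (2 * t)) (cong (λ s → step s (p (2 * t))) e)
        with i , l , pa , el , st₂ ← descent-moves L (p (2 * t)) (p (suc (2 * t)))
               (subst (λ s → Legal s (p (2 * t))) e (legal (2 * t)))
               (subst (λ s → Legal s (p (suc (2 * t)))) after-JUST (legal (suc (2 * t)))) =
        record { move≡ = pa ; loc≡ = el
               ; after = trans (cong state (*-suc 2 t)) (trans (state-suc (suc (2 * t)))
                           (trans (cong (λ s → step s (p (suc (2 * t)))) after-JUST) st₂)) }

      locs : ℕ → List Loc
      locs≡ : ∀ t → state (2 * t) ≡ atP (locs t)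
      locs zero = initLocs
      locs (suc t) = extendL (locs t) (LocalDescent.loc (descent-at t (locs t) (locs≡ t))) (p (suc (2 * t)))
      locs≡ zero = refl
      locs≡ (suc t) = LocalDescent.after (descent-at t (locs t) (locs≡ t))

      locs-mono : ∀ {t t'} → t ≤ t' → ∀ k {x} → locs t !! k ≡ just x → locs t' !! k ≡ just x
      locs-mono le k {x} = step-preserved (λ t → locs t !! k ≡ just x) (λ t → !!-++ˡ (locs t) _ k) le

      locs-agree : ∀ t t' k {x x'} → locs t !! k ≡ just x → locs t' !! k ≡ just x' → x ≡ x'
      locs-agree t t' k e e' with ≤-total t t'
      ... | inj₁ le = just-injective (trans (sym (locs-mono le k e)) e')
      ... | inj₂ le = just-injective (trans (sym e) (locs-mono le k e'))

      locs-good : ∀ t → GoodL (locs t)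
      locs-good t = subst Good (locs≡ t) (GoodPath-last init (prefix p (2 * t)) (proj₂ (inσ (2 * t))))

      not-P-won : ¬ ForallPwin p
      not-P-won (g , q , (js , js₀ , chain) , pw) = τ-play g q (λ s → in-τ s) pw
        where
        located : ∀ s → Σ ℕ λ t → locs t !! js s ≡ just (g , prefix q s)
        located zero = 0 , subst (λ k → initLocs !! k ≡ just (g , [])) (sym js₀) (initLocs-root g)
        located (suc s) with t₀ , e₀ ← located s with t' , pa , pm ← proj₂ (chain s) = suc t' , located-suc
          where
          open LocalDescent (descent-at t' (locs t') (locs≡ t'))
          js≡ : (js s ≡ from) × (js (suc s) ≡ length (locs t'))
          js≡ = JUST-injective (trans (sym pa) move≡)
          loc≡g : loc ≡ (g , prefix q s)
          loc≡g = locs-agree t' t₀ (js s) (subst (λ k → locs t' !! k ≡ just loc) (sym (proj₁ js≡)) loc≡) e₀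
          located-suc : locs (suc t') !! js (suc s) ≡ just (g , prefix q s ++ [ q s ])
          located-suc = trans (cong (locs (suc t') !!_) (proj₂ js≡))
                          (trans (!!-∷ʳ-length (locs t') _) (cong just (cong₂ extend loc≡g pm)))
        in-τ : ∀ s → τ g (prefix q s)
        in-τ s = locs-good (proj₁ (located s)) _ g (prefix q s) (proj₂ (located s))

    σ-winning : IsGWinning ForallArena O σ
    σ-winning = (((((λ _ → proj₁) , (tt , GoodL-initLocs) , prefix-closed) , P-moves) , σ-O-total) , leaves) , not-P-won
      where
      prefix-closed : ∀ x y → σ (x ++ y) → σ x
      prefix-closed x y (v , g) = ValidFrom-prefix init x y v , GoodPath-prefix init x y g
      P-moves : ∀ x → σ x → NonLeaf ForallArena x → turnS (run init x) ≡ P →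
                ∀ m → ValidFrom init (x ++ [ m ]) → σ (x ++ [ m ])
      P-moves x (v , gp) _ t m v' =
        v' , GoodPath-∷ʳ init x m gp (P-move-good (run init x) m (GoodPath-last init x gp) t (ValidFrom-∷ʳ⁻ init x m v'))
      leaves : ∀ x → σ x → Leaf ForallArena x → winS (run init x) ≡ pl O
      leaves x (_ , gp) _ = Good⇒winS (run init x) (GoodPath-last init x gp)

  EXH-total : IsGTotal ForallArena P EXH
  EXH-total = (((λ x → InExhAt⇒valid exh₀ x sh₀) , tt , InExhAt-prefix exh₀) ,
               (λ x h _ → InExhAt-O-closed exh₀ x sh₀ h)) ,
              (λ x h → InExhAt-P-total exh₀ x sh₀ h)
    where
    sh₀ : WellShaped exh₀
    sh₀ = wellShaped invariant₀

  OWinsUnderAssignment⇒OWins : FVEmpty n Γ I → OWinsUnderAssignment →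
                               Σ (List Move → Set) λ σ → IsGWinning ForallArena O σ
  OWinsUnderAssignment⇒OWins fv (η , η-assignment , τs) = σ , σ-winning
    where open FromLocalStrategies fv η η-assignment τs

  EXH-not-winning⇒OWinsUnderAssignment : ExcludedMiddle (Level.suc 0ℓ) → FVEmpty n Γ I →
                                          ¬ IsGWinning ForallArena P EXH → OWinsUnderAssignment
  EXH-not-winning⇒OWinsUnderAssignment em fv ¬win with not-winning⇒losing-play em ForallArena EXH-total ¬win
  ... | inj₁ (x , h , (v , nl) , lost) with S , iv , ex ← finite-failure-exhausted exh₀ x invariant₀ h v nl lost =
    branch⇒OWinsUnderAssignment em fv (exhausted-branch S iv ex)
  ... | inj₂ (p , h , lost) = branch⇒OWinsUnderAssignment em fv (InfinitePlay.play-branch p h lost)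

mainTheorem3 : ExcludedMiddle (Level.suc 0ℓ) → (𝒫 : ParSig) →
    let open ParSig 𝒫 in let open WithPar 𝒫 in
    (n : ℕ) (Γ : Fin n → Game) (I : Par → Bool) → SelfDual I → FVEmpty n Γ I →
    let open Forall n Γ I in
    ((Σ (Par → Player) λ η → IsAssignment I η ×
        (∀ i → Σ (List Move → Set) λ τ → IsGWinning (gameArena (assignG I η (Γ i))) O τ))
      ⇔ (Σ (List Move → Set) λ σ → IsGWinning ForallArena O σ))
    × ((Σ (List Move → Set) λ σ → IsGWinning ForallArena O σ)
      ⇔ (¬ Σ (List Move → Set) λ σ → IsGWinning ForallArena P σ))
    × ((¬ Σ (List Move → Set) λ σ → IsGWinning ForallArena P σ)
      ⇔ (¬ IsGWinning ForallArena P EXH))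
mainTheorem3 em 𝒫 n Γ I _ fv =
  mk⇔ 1⇒2 (4⇒1 ∘ 3⇒4 ∘ 2⇒3) , mk⇔ 2⇒3 (1⇒2 ∘ 4⇒1 ∘ 3⇒4) , mk⇔ 3⇒4 (2⇒3 ∘ 1⇒2 ∘ 4⇒1)
  where
  open WithPar 𝒫
  open Forall n Γ I
  open ForallGame 𝒫 n Γ I
  1⇒2 : OWinsUnderAssignment → Σ (List Move → Set) λ σ → IsGWinning ForallArena O σ
  1⇒2 = OWinsUnderAssignment⇒OWins fv
  2⇒3 : (Σ (List Move → Set) λ σ → IsGWinning ForallArena O σ) →
        ¬ Σ (List Move → Set) λ σ → IsGWinning ForallArena P σ
  2⇒3 (σ , σ-wins) (τ , τ-wins) = Games.winning-exclusive 𝒫 em ForallArena σ-wins τ-wins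
  3⇒4 : (¬ Σ (List Move → Set) λ σ → IsGWinning ForallArena P σ) → ¬ IsGWinning ForallArena P EXH
  3⇒4 ¬P-wins EXH-wins = ¬P-wins (EXH , EXH-wins)
  4⇒1 : ¬ IsGWinning ForallArena P EXH → OWinsUnderAssignment
  4⇒1 = EXH-not-winning⇒OWinsUnderAssignment em fv
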